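{- If $G$ is a traceable graph with $\delta(G) \geq 4$, then $M'_D(G) \leq 3$.
   Context: Graphs are finite, simple and undirected. A graph is traceable if it has a Hamiltonian (spanning) path. A majority edge coloring is an edge coloring such that for every vertex $u$ and every color $\alpha$, at most half of the edges incident with $u$ have color $\alpha$. It is distinguishing if the only automorphism $\varphi$ of $G$ with $c(\varphi(u)\varphi(v))=c(uv)$ for all edges $uv$ is the identity. $M'_D(G)$ is the least number of colors in an edge coloring of $G$ that is both majority and distinguishing. -}

module Defs where

open import Data.Nat using (ℕ; zero; suc; _+_; _*_; _≤_)
open import Data.Fin using (Fin; toℕ; _≟_)
import Data.Fin as F
open import Data.Bool using (Bool; true; false; _∧_; if_then_else_)
open import Data.Product using (Σ; _×_; ∃-syntax)
open import Relation.Nullary.Decidable using (⌊_⌋)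
open import Relation.Binary.PropositionalEquality using (_≡_)
open import Data.Fin.Permutation using (Permutation′; _⟨$⟩ʳ_)

record Graph (n : ℕ) : Set where
  field
    adj     : Fin n → Fin n → Bool
    sym     : ∀ u v → adj u v ≡ adj v u
    irrefl  : ∀ u → adj u u ≡ false
open Graph public

count : ∀ {n} → (Fin n → Bool) → ℕ
count {zero}  f = 0
count {suc n} f = (if f F.zero then 1 else 0) + count (λ i → f (F.suc i))

degree : ∀ {n} → Graph n → Fin n → ℕ
degree G u = count (adj G u)

MinDegree≥ : ∀ {n} → Graph n → ℕ → Set
MinDegree≥ G d = ∀ u → d ≤ degree G u

Traceable : ∀ {n} → Graph n → Set
Traceable {n} G = Σ (Permutation′ n) λ p →
  ∀ (i j : Fin n) → toℕ j ≡ suc (toℕ i) → adj G (p ⟨$⟩ʳ i) (p ⟨$⟩ʳ j) ≡ true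

-- An edge coloring with colors in Fin k: a function on ordered pairs whose
-- values on edges are symmetric (values on non-edges are irrelevant).
record EdgeColoring {n} (G : Graph n) (k : ℕ) : Set where
  field
    col    : Fin n → Fin n → Fin k
    colSym : ∀ u v → adj G u v ≡ true → col u v ≡ col v u
open EdgeColoring public

IsMajority : ∀ {n k} {G : Graph n} → EdgeColoring G k → Set
IsMajority {n} {k} {G} c = ∀ (u : Fin n) (α : Fin k) →
  2 * count (λ v → adj G u v ∧ ⌊ col c u v ≟ α ⌋) ≤ degree G u

IsAutomorphism : ∀ {n} → Graph n → Permutation′ n → Set
IsAutomorphism {n} G φ = ∀ (u v : Fin n) → adj G (φ ⟨$⟩ʳ u) (φ ⟨$⟩ʳ v) ≡ adj G u v

IsDistinguishing : ∀ {n k} {G : Graph n} → EdgeColoring G k → Set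
IsDistinguishing {n} {k} {G} c = ∀ (φ : Permutation′ n) → IsAutomorphism G φ →
  (∀ (u v : Fin n) → adj G u v ≡ true → col c (φ ⟨$⟩ʳ u) (φ ⟨$⟩ʳ v) ≡ col c u v) →
  ∀ (u : Fin n) → φ ⟨$⟩ʳ u ≡ u

M'D≤ : ∀ {n} → Graph n → ℕ → Set
M'D≤ G k = Σ (EdgeColoring G k) λ c → IsMajority c × IsDistinguishing c

{-# OPTIONS --safe #-}

-- Colour the edges of the Hamiltonian path 0 and the remaining edges (chords) 1 and 2. An
-- automorphism preserving the colouring maps the path onto itself, so it fixes every vertex or
-- reverses the path; the reversal is excluded once the numbers of chords of colour 1 differ at the
-- two ends s₀, s₁ or at their path neighbours q₀, q₁. Colour 0 is never a majority since δ ≥ 4, and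
-- colours 1 and 2 are not either if the chord colouring is balanced up to 2 at inner vertices and
-- up to 1 at the ends, which lie on only one path edge.
--
-- Balanced 2-colourings come from splitting off: in a multigraph whose edges may be twisted (ends
-- of different colours), two edges at w are replaced by one edge joining their far ends, twisted so
-- that every colouring of the new graph lifts with one end of each colour at w and unchanged excess
-- of one colour over the other everywhere. After splitting until all degrees are at most 2, and at
-- most 1 at chosen vertices, a constant colouring lifts to the required one. The asymmetry is free
-- when the chord degrees at s₀, s₁ or at q₀, q₁ differ. Otherwise a twisted virtual edge joining
-- the pair (plus an untwisted one if needed) makes both degrees even: a colouring exactly balanced
-- at both vertices then cannot give them equally many chords of colour 1, since the virtual edges
-- contribute an odd number of colour-1 ends to the pair.

module Submission where

open import Data.Nat using (ℕ; zero; suc; _+_; _*_; _∸_; _≤_; _<_; z≤n; s≤s)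
open import Data.Nat.Properties hiding (_≟_; _<?_; suc-injective)
import Data.Nat.Properties as ℕ
open import Data.Nat.DivMod using (_mod_; m<n⇒m%n≡m)
open import Data.Nat.Tactic.RingSolver using (solve-∀)
open import Algebra.Properties.CommutativeSemigroup +-commutativeSemigroup
  using (interchange; xy∙z≈xz∙y; x∙yz≈y∙xz)
open import Algebra.Properties.CommutativeMonoid.Sum +-0-commutativeMonoid
  using (sum; sum-cong-≗; ∑-distrib-+; ∑-permute)
open import Data.Fin using (Fin; zero; suc; toℕ; fromℕ; fromℕ<; inject₁)
open import Data.Fin.Properties
  using (_≟_; _<?_; any?; suc-injective; toℕ-injective; toℕ<n; toℕ-fromℕ<; toℕ-fromℕ; toℕ-inject₁)
open import Data.Fin.Permutation using (Permutation′; _⟨$⟩ʳ_; _⟨$⟩ˡ_; inverseʳ; inverseˡ)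
open import Data.Bool using (Bool; true; false; _∧_; _∨_; not; _xor_; if_then_else_)
open import Data.Bool.Properties
  using (∧-comm; ∧-zeroʳ; ∧-identityʳ; ∧-distribˡ-∨; ∧-distribʳ-∨; ∨-comm; ∨-zeroʳ; ∨-identityʳ; ∨-idem;
         xor-assoc; xor-same; xor-identityʳ)
open import Data.List using (List; []; _∷_; map; length; _++_; concatMap; tabulate; allFin)
open import Data.List.Properties using (∷-injective; map-∘; map-id)
open import Data.List.Membership.Propositional using (_∈_; _∉_)
open import Data.List.Relation.Unary.Any using (here; there)
import Data.List.Relation.Unary.Any as Any
open import Data.List.Relation.Binary.Permutation.Propositional
  using (_↭_; prep; swap; ↭-sym; ↭-reflexive) renaming (refl to ↭-refl; trans to ↭-trans)
open import Data.List.Relation.Binary.Permutation.Propositional.Properties using (↭-length; ↭-map-inv)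
open import Data.Product using (Σ; _×_; _,_; proj₁; proj₂; ∃; ∃-syntax)
open import Data.Sum using (_⊎_; inj₁; inj₂; [_,_]′)
open import Data.Unit using (⊤; tt)
open import Data.Empty using (⊥; ⊥-elim)
open import Function using (_∘_)
open import Relation.Nullary using (¬_; Dec; yes; no; does; contradiction)
open import Relation.Nullary.Decidable using (⌊_⌋; dec-true; dec-false)
open import Relation.Binary.PropositionalEquality
open import Defs hiding (sym; irrefl)

private variable
  n : ℕ
  A B : Set

-- Indicators, sums and counting

ind : Bool → ℕ
ind b = if b then 1 else 0

ind≤1 : ∀ b → ind b ≤ 1
ind≤1 true  = ≤-refl
ind≤1 false = z≤n

ind-∧≤ˡ : ∀ a b → ind (a ∧ b) ≤ ind a
ind-∧≤ˡ true  b = ind≤1 b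
ind-∧≤ˡ false b = z≤n

ind-∨≤ : ∀ a b → ind (a ∨ b) ≤ ind a + ind b
ind-∨≤ true  b = s≤s z≤n
ind-∨≤ false b = ≤-refl

ind+ind≤2*ind-∨ : ∀ a b → ind a + ind b ≤ 2 * ind (a ∨ b)
ind+ind≤2*ind-∨ true  true  = ≤-refl
ind+ind≤2*ind-∨ true  false = s≤s z≤n
ind+ind≤2*ind-∨ false true  = s≤s z≤n
ind+ind≤2*ind-∨ false false = z≤n

∧-true : ∀ {a b} → a ∧ b ≡ true → a ≡ true × b ≡ true
∧-true {true} {true} _ = refl , refl

∨-true : ∀ {a b} → a ∨ b ≡ true → a ≡ true ⊎ b ≡ true
∨-true {true}  _ = inj₁ refl
∨-true {false} b = inj₂ b

not-true : ∀ {a} → not a ≡ true → a ≡ false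
not-true {false} _ = refl

not-false : ∀ {a} → not a ≡ false → a ≡ true
not-false {true} _ = refl

ind-∨-disjoint : ∀ a b → (a ≡ true → b ≡ false) → ind (a ∨ b) ≡ ind a + ind b
ind-∨-disjoint true  b a⇒¬b rewrite a⇒¬b refl = refl
ind-∨-disjoint false b a⇒¬b = refl

_==ᵇ_ : Bool → Bool → Bool
true  ==ᵇ b = b
false ==ᵇ b = not b

ind-∧-==ᵇ-split : ∀ a y → ind (a ∧ (y ==ᵇ true)) + ind (a ∧ (y ==ᵇ false)) ≡ ind a
ind-∧-==ᵇ-split true  true  = refl
ind-∧-==ᵇ-split true  false = refl
ind-∧-==ᵇ-split false y     = refl

ind-∧-==ᵇ-not : ∀ a y c → ind (a ∧ (y ==ᵇ c)) + ind (a ∧ (not y ==ᵇ c)) ≡ ind a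
ind-∧-==ᵇ-not true  true  true  = refl
ind-∧-==ᵇ-not true  true  false = refl
ind-∧-==ᵇ-not true  false true  = refl
ind-∧-==ᵇ-not true  false false = refl
ind-∧-==ᵇ-not false y     c     = refl

does⇒ : (d : Dec A) → does d ≡ true → A
does⇒ (yes a) _ = a

does-⇔ : ∀ {P Q : Set} → (P → Q) → (Q → P) → (p : Dec P) (q : Dec Q) → does p ≡ does q
does-⇔ P⇒Q Q⇒P (yes p) (yes q) = refl
does-⇔ P⇒Q Q⇒P (yes p) (no ¬q) = contradiction (P⇒Q p) ¬q
does-⇔ P⇒Q Q⇒P (no ¬p) (yes q) = contradiction (Q⇒P q) ¬p
does-⇔ P⇒Q Q⇒P (no ¬p) (no ¬q) = refl

_==_ : Fin n → Fin n → Bool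
i == j = does (i ≟ j)

==-refl : (i : Fin n) → i == i ≡ true
==-refl zero    = refl
==-refl (suc i) = ==-refl i

==-sym : (i j : Fin n) → i == j ≡ j == i
==-sym zero    zero    = refl
==-sym zero    (suc j) = refl
==-sym (suc i) zero    = refl
==-sym (suc i) (suc j) = ==-sym i j

sumMap : (A → ℕ) → List A → ℕ
sumMap f []       = 0
sumMap f (x ∷ xs) = f x + sumMap f xs

sumMap-↭ : ∀ (f : A → ℕ) {xs ys} → xs ↭ ys → sumMap f xs ≡ sumMap f ys
sumMap-↭ f ↭-refl          = refl
sumMap-↭ f (prep x p)      = cong (f x +_) (sumMap-↭ f p)
sumMap-↭ f (swap x y p)    =
  trans (cong (λ s → f x + (f y + s)) (sumMap-↭ f p)) (x∙yz≈y∙xz (f x) (f y) _)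
sumMap-↭ f (↭-trans p q)   = trans (sumMap-↭ f p) (sumMap-↭ f q)

sumMap-map : ∀ (f : B → ℕ) (g : A → B) xs → sumMap f (map g xs) ≡ sumMap (f ∘ g) xs
sumMap-map f g []       = refl
sumMap-map f g (x ∷ xs) = cong (f (g x) +_) (sumMap-map f g xs)

sumMap-cong : ∀ {f g : A → ℕ} xs → (∀ x → f x ≡ g x) → sumMap f xs ≡ sumMap g xs
sumMap-cong []       f≗g = refl
sumMap-cong (x ∷ xs) f≗g = cong₂ _+_ (f≗g x) (sumMap-cong xs f≗g)

sumMap-mono-≤ : ∀ {f g : A → ℕ} xs → (∀ x → f x ≤ g x) → sumMap f xs ≤ sumMap g xs
sumMap-mono-≤ []       f≤g = z≤n
sumMap-mono-≤ (x ∷ xs) f≤g = +-mono-≤ (f≤g x) (sumMap-mono-≤ xs f≤g)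

sumMap-distrib-+ : ∀ (f g : A → ℕ) xs → sumMap (λ x → f x + g x) xs ≡ sumMap f xs + sumMap g xs
sumMap-distrib-+ f g []       = refl
sumMap-distrib-+ f g (x ∷ xs) =
  trans (cong (f x + g x +_) (sumMap-distrib-+ f g xs)) (interchange (f x) (g x) _ _)

sumMap-distribˡ-* : ∀ k (f : A → ℕ) xs → sumMap (λ x → k * f x) xs ≡ k * sumMap f xs
sumMap-distribˡ-* k f []       = sym (*-zeroʳ k)
sumMap-distribˡ-* k f (x ∷ xs) =
  trans (cong (k * f x +_) (sumMap-distribˡ-* k f xs)) (sym (*-distribˡ-+ k (f x) _))

sumMap-++ : ∀ (f : A → ℕ) xs ys → sumMap f (xs ++ ys) ≡ sumMap f xs + sumMap f ys
sumMap-++ f []       ys = refl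
sumMap-++ f (x ∷ xs) ys = trans (cong (f x +_) (sumMap-++ f xs ys)) (sym (+-assoc (f x) _ _))

sumMap-concatMap : ∀ (f : B → ℕ) (g : A → List B) xs →
  sumMap f (concatMap g xs) ≡ sumMap (sumMap f ∘ g) xs
sumMap-concatMap f g []       = refl
sumMap-concatMap f g (x ∷ xs) =
  trans (sumMap-++ f (g x) (concatMap g xs)) (cong (sumMap f (g x) +_) (sumMap-concatMap f g xs))

sumMap-tabulate : ∀ (f : A → ℕ) (g : Fin n → A) → sumMap f (tabulate g) ≡ sum (f ∘ g)
sumMap-tabulate {n = zero}  f g = refl
sumMap-tabulate {n = suc n} f g = cong (f (g zero) +_) (sumMap-tabulate f (g ∘ suc))

sum-≡0 : ∀ (f : Fin n → ℕ) → (∀ i → f i ≡ 0) → sum f ≡ 0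
sum-≡0 {n = zero}  f f≗0 = refl
sum-≡0 {n = suc n} f f≗0 = cong₂ _+_ (f≗0 zero) (sum-≡0 (f ∘ suc) (f≗0 ∘ suc))

sum-mono-≤ : ∀ {f g : Fin n → ℕ} → (∀ i → f i ≤ g i) → sum f ≤ sum g
sum-mono-≤ {n = zero}  f≤g = z≤n
sum-mono-≤ {n = suc n} f≤g = +-mono-≤ (f≤g zero) (sum-mono-≤ (f≤g ∘ suc))

sum-at : ∀ (j : Fin n) (g : Fin n → ℕ) → sum (λ i → if j == i then g i else 0) ≡ g j
sum-at {n = suc n} zero g =
  trans (cong (g zero +_) (sum-≡0 {n = n} _ (λ _ → refl))) (+-identityʳ (g zero))
sum-at {n = suc n} (suc j) g = sum-at j (g ∘ suc)

sum-ind-∧-== : ∀ (x : Fin n → Bool) w → sum (λ v → ind (x v ∧ (w == v))) ≡ ind (x w)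
sum-ind-∧-== x w = trans (sum-cong-≗ pointwise) (sum-at w (ind ∘ x))
  where
  pointwise : ∀ v → ind (x v ∧ (w == v)) ≡ (if w == v then ind (x v) else 0)
  pointwise v with w == v
  ... | true  = cong ind (∧-identityʳ (x v))
  ... | false = cong ind (∧-zeroʳ (x v))

sum₂-at : ∀ (F : Fin n → Fin n → Bool) u v → sum (λ a → sum (λ b → ind (F a b ∧ (a == u ∧ b == v)))) ≡ ind (F u v)
sum₂-at F u v = trans (sum-cong-≗ row) (sum-at u (λ a → ind (F a v)))
  where
  row : ∀ a → sum (λ b → ind (F a b ∧ (a == u ∧ b == v))) ≡ (if u == a then ind (F a v) else 0)
  row a with a ≟ u
  ... | yes refl rewrite ==-refl a = trans (sum-cong-≗ λ b → cong (λ y → ind (F a b ∧ y)) (==-sym b v))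
                                           (sum-ind-∧-== (F a) v)
  ... | no a≢u rewrite dec-false (u ≟ a) (a≢u ∘ sym) = sum-≡0 _ λ b → cong ind (∧-zeroʳ (F a b))

sum-sumMap-comm : ∀ (F : Fin n → A → ℕ) xs →
  sum (λ i → sumMap (F i) xs) ≡ sumMap (λ x → sum (λ i → F i x)) xs
sum-sumMap-comm {n = n} F []       = sum-≡0 {n = n} (λ _ → 0) (λ _ → refl)
sum-sumMap-comm F (x ∷ xs) =
  trans (∑-distrib-+ (λ i → F i x) (λ i → sumMap (F i) xs))
        (cong (sum (λ i → F i x) +_) (sum-sumMap-comm F xs))

ind-<-split : ∀ (u v : Fin n) c → ¬ u ≡ v → ind (does (u <? v) ∧ c) + ind (does (v <? u) ∧ c) ≡ ind c
ind-<-split u v c u≢v = split (u <? v) (v <? u)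
  where
  split : (p : Dec (toℕ u < toℕ v)) (q : Dec (toℕ v < toℕ u)) → ind (does p ∧ c) + ind (does q ∧ c) ≡ ind c
  split (yes u<v) (yes v<u) = contradiction u<v (<-asym v<u)
  split (yes _)   (no _)    = +-identityʳ (ind c)
  split (no _)    (yes _)   = refl
  split (no u≮v)  (no v≮u)  = contradiction (toℕ-injective (≤-antisym (≮⇒≥ v≮u) (≮⇒≥ u≮v))) u≢v

count≡sum : ∀ (f : Fin n → Bool) → count f ≡ sum (ind ∘ f)
count≡sum {n = zero}  f = refl
count≡sum {n = suc n} f = cong (ind (f zero) +_) (count≡sum (f ∘ suc))

count-cong : ∀ {f g : Fin n → Bool} → (∀ i → f i ≡ g i) → count f ≡ count g
count-cong {n = zero}  f≗g = refl
count-cong {n = suc n} f≗g = cong₂ _+_ (cong ind (f≗g zero)) (count-cong (f≗g ∘ suc))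

count-mono : ∀ {f g : Fin n → Bool} → (∀ i → f i ≡ true → g i ≡ true) → count f ≤ count g
count-mono {n = zero}  f⇒g = z≤n
count-mono {n = suc n} {f} {g} f⇒g = +-mono-≤ (ind-mono (f zero) (g zero) (f⇒g zero)) (count-mono (f⇒g ∘ suc))
  where
  ind-mono : ∀ a b → (a ≡ true → b ≡ true) → ind a ≤ ind b
  ind-mono true  b a⇒b rewrite a⇒b refl = ≤-refl
  ind-mono false b a⇒b = z≤n

count-∨≤ : ∀ (f g : Fin n → Bool) → count (λ i → f i ∨ g i) ≤ count f + count g
count-∨≤ {n = zero}  f g = z≤n
count-∨≤ {n = suc n} f g = begin
  ind (f zero ∨ g zero) + count (λ i → f (suc i) ∨ g (suc i))
    ≤⟨ +-mono-≤ (ind-∨≤ (f zero) (g zero)) (count-∨≤ (f ∘ suc) (g ∘ suc)) ⟩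
  ind (f zero) + ind (g zero) + (count (f ∘ suc) + count (g ∘ suc))
    ≡⟨ interchange (ind (f zero)) (ind (g zero)) _ _ ⟩
  count f + count g ∎
  where open ≤-Reasoning

count-permute : ∀ (f : Fin n → Bool) (π : Permutation′ n) → count (f ∘ (π ⟨$⟩ʳ_)) ≡ count f
count-permute f π = begin
  count (f ∘ (π ⟨$⟩ʳ_))     ≡⟨ count≡sum (f ∘ (π ⟨$⟩ʳ_)) ⟩
  sum (ind ∘ f ∘ (π ⟨$⟩ʳ_)) ≡⟨ ∑-permute (ind ∘ f) π ⟨
  sum (ind ∘ f)             ≡⟨ count≡sum f ⟨
  count f                   ∎
  where open ≡-Reasoning

count-false : count {n} (λ _ → false) ≡ 0
count-false {n = zero}  = refl
count-false {n = suc n} = count-false {n}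

count-none : ∀ (f : Fin n → Bool) → (∀ i → f i ≡ false) → count f ≡ 0
count-none {n} f none = trans (count-cong none) (count-false {n})

count-≤1 : ∀ (f : Fin n → Bool) → (∀ i j → f i ≡ true → f j ≡ true → i ≡ j) → count f ≤ 1
count-≤1 {n = zero}  f unique = z≤n
count-≤1 {n = suc n} f unique with f zero in f0
... | true  = s≤s (≤-trans (count-mono {g = λ _ → false} (λ i fi → contradiction (unique zero (suc i) f0 fi) λ ()))
                          (≤-reflexive (count-false {n})))
... | false = count-≤1 (f ∘ suc) (λ i j fi fj → suc-injective (unique (suc i) (suc j) fi fj))

count-≥1 : ∀ (f : Fin n → Bool) i → f i ≡ true → 1 ≤ count f
count-≥1 f zero    fi rewrite fi = s≤s z≤n
count-≥1 f (suc i) fi = ≤-trans (count-≥1 (f ∘ suc) i fi) (m≤n+m _ _)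

count-≥2 : ∀ (f : Fin n → Bool) {i j} → ¬ i ≡ j → f i ≡ true → f j ≡ true → 2 ≤ count f
count-≥2 f {zero}  {zero}  i≢j fi fj = contradiction refl i≢j
count-≥2 f {zero}  {suc j} i≢j fi fj rewrite fi = s≤s (count-≥1 (f ∘ suc) j fj)
count-≥2 f {suc i} {zero}  i≢j fi fj rewrite fj = s≤s (count-≥1 (f ∘ suc) i fi)
count-≥2 f {suc i} {suc j} i≢j fi fj =
  ≤-trans (count-≥2 (f ∘ suc) (i≢j ∘ cong suc) fi fj) (m≤n+m _ _)

count≤n : ∀ (f : Fin n → Bool) → count f ≤ n
count≤n {n = zero}  f = z≤n
count≤n {n = suc n} f = +-mono-≤ (ind≤1 (f zero)) (count≤n (f ∘ suc))

count-< : ∀ (f : Fin n → Bool) i → f i ≡ false → count f < n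
count-< f zero    fi rewrite fi = s≤s (count≤n (f ∘ suc))
count-< f (suc i) fi =
  ≤-trans (≤-reflexive (sym (+-suc (ind (f zero)) _))) (+-mono-≤ (ind≤1 (f zero)) (count-< (f ∘ suc) i fi))

count-witness : ∀ (f : Fin n → Bool) → 1 ≤ count f → ∃ λ i → f i ≡ true
count-witness {n = suc n} f pos with f zero in f0
... | true  = zero , f0
... | false with i , fi ← count-witness (f ∘ suc) pos = suc i , fi

find-↭ : ∀ (p : A → Bool) xs →
  (∃ λ x → ∃ λ rs → p x ≡ true × xs ↭ x ∷ rs) ⊎ sumMap (ind ∘ p) xs ≡ 0
find-↭ p []       = inj₂ refl
find-↭ p (x ∷ xs) with p x in px
... | true  = inj₁ (x , xs , px , ↭-refl)
... | false with find-↭ p xs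
...   | inj₁ (y , rs , py , xs↭) = inj₁ (y , x ∷ rs , py , ↭-trans (prep x xs↭) (swap x y ↭-refl))
...   | inj₂ none                = inj₂ none

even-or-odd : ∀ n → (∃ λ k → n ≡ 2 * k) ⊎ (∃ λ k → n ≡ suc (2 * k))
even-or-odd zero    = inj₁ (0 , refl)
even-or-odd (suc n) with even-or-odd n
... | inj₁ (k , n≡2k)   = inj₂ (k , cong suc n≡2k)
... | inj₂ (k , n≡2k+1) = inj₁ (suc k , trans (cong suc n≡2k+1) (sym (*-distribˡ-+ 2 1 k)))

odd+1≡even : ∀ k → suc (2 * k) + 1 ≡ 2 * suc k
odd+1≡even = solve-∀

even+2≡even : ∀ k → 2 * k + 2 ≡ 2 * suc k
even+2≡even = solve-∀

slack-≤ : ∀ {R h b P} → R ≤ h + b → b ≤ P → R ≤ P + h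
slack-≤ {h = h} {P = P} R≤ b≤P = ≤-trans R≤ (≤-trans (+-monoʳ-≤ h b≤P) (≤-reflexive (+-comm h P)))

-- Injective maps with unit steps

module UnitSteps (N : ℕ) (h : ℕ → ℕ)
  (step : ∀ k → suc k ≤ N → h (suc k) ≡ suc (h k) ⊎ h k ≡ suc (h (suc k)))
  (injective : ∀ a b → a ≤ N → b ≤ N → h a ≡ h b → a ≡ b)
  (bounded : ∀ k → k ≤ N → h k ≤ N) where

  private
    lower : ∀ {k} → suc k ≤ N → k ≤ N
    lower = ≤-trans (n≤1+n _)

  no-return : ∀ k → suc (suc k) ≤ N → ¬ h (suc (suc k)) ≡ h k
  no-return k k+2≤N eq = m≢1+n+m k {1} (sym (injective _ _ k+2≤N (lower (lower k+2≤N)) eq))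

  ascending : h 1 ≡ suc (h 0) → ∀ k → k ≤ N → h k ≡ h 0 + k
  ascending up zero    _     = sym (+-identityʳ (h 0))
  ascending up (suc k) k+1≤N with step k k+1≤N
  ... | inj₁ forward = trans forward (trans (cong suc (ascending up k (lower k+1≤N))) (sym (+-suc (h 0) k)))
  ... | inj₂ back    = contradiction back (turn k k+1≤N)
    where
    turn : ∀ k → suc k ≤ N → ¬ h k ≡ suc (h (suc k))
    turn zero    _     back = m≢1+n+m (h 0) {1} (trans back (cong suc up))
    turn (suc k) k+2≤N back = no-return k k+2≤N (ℕ.suc-injective (begin
      suc (h (suc (suc k))) ≡⟨ back ⟨
      h (suc k)             ≡⟨ ascending up (suc k) (lower k+2≤N) ⟩
      h 0 + suc k           ≡⟨ +-suc (h 0) k ⟩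
      suc (h 0 + k)         ≡⟨ cong suc (ascending up k (lower (lower k+2≤N))) ⟨
      suc (h k)             ∎))
      where open ≡-Reasoning

  descending : h 0 ≡ suc (h 1) → ∀ k → k ≤ N → h k + k ≡ h 0
  descending down zero    _     = +-identityʳ (h 0)
  descending down (suc k) k+1≤N with step k k+1≤N
  ... | inj₂ back    = trans (+-suc (h (suc k)) k) (trans (cong (_+ k) (sym back)) (descending down k (lower k+1≤N)))
  ... | inj₁ forward = contradiction forward (turn k k+1≤N)
    where
    turn : ∀ k → suc k ≤ N → ¬ h (suc k) ≡ suc (h k)
    turn zero    _     fwd = m≢1+n+m (h 1) {1} (trans fwd (cong suc down))
    turn (suc k) k+2≤N fwd = no-return k k+2≤N (+-cancelʳ-≡ k _ _ (begin
      h (suc (suc k)) + k   ≡⟨ cong (_+ k) fwd ⟩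
      suc (h (suc k) + k)   ≡⟨ +-suc (h (suc k)) k ⟨
      h (suc k) + suc k     ≡⟨ descending down (suc k) (lower k+2≤N) ⟩
      h 0                   ≡⟨ descending down k (lower (lower k+2≤N)) ⟨
      h k + k               ∎))
      where open ≡-Reasoning

  identity-or-reflection : 1 ≤ N → (∀ k → k ≤ N → h k ≡ k) ⊎ (∀ k → k ≤ N → h k + k ≡ N)
  identity-or-reflection 1≤N with step 0 1≤N
  ... | inj₁ up   = inj₁ λ k k≤N → trans (ascending up k k≤N) (cong (_+ k) h0≡0)
    where
    h0≡0 : h 0 ≡ 0
    h0≡0 = n≤0⇒n≡0 (+-cancelʳ-≤ N (h 0) 0 (subst (_≤ N) (ascending up N ≤-refl) (bounded N ≤-refl)))
  ... | inj₂ down = inj₂ λ k k≤N → trans (descending down k k≤N) h0≡N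
    where
    h0≡N : h 0 ≡ N
    h0≡N = ≤-antisym (bounded 0 z≤n) (subst (N ≤_) (descending down N ≤-refl) (m≤n+m N (h N)))

-- Multigraphs with twisted edges, and splitting off

-- A twisted edge has ends of different colours; virtual edges are auxiliary, not edges of the graph.
record Edge (n : ℕ) : Set where
  constructor edge
  field
    src dst : Fin n
    twisted virtual : Bool
open Edge public

-- The colour of the src end; the dst end has colour  x xor twisted e.
Coloured : ℕ → Set
Coloured n = Edge n × Bool

ends : Fin n → Edge n → ℕ
ends u e = ind (src e == u) + ind (dst e == u)

colouredEnds : Fin n → Bool → Coloured n → ℕ
colouredEnds u c (e , x) = ind (src e == u ∧ (x ==ᵇ c)) + ind (dst e == u ∧ ((x xor twisted e) ==ᵇ c))

deg : Fin n → List (Edge n) → ℕ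
deg u = sumMap (ends u)

colourDeg : Fin n → Bool → List (Coloured n) → ℕ
colourDeg u c = sumMap (colouredEnds u c)

ends≤2 : ∀ u (e : Edge n) → ends u e ≤ 2
ends≤2 u e = +-mono-≤ (ind≤1 (src e == u)) (ind≤1 (dst e == u))

colouredEnds≤ends : ∀ u c (ce : Coloured n) → colouredEnds u c ce ≤ ends u (proj₁ ce)
colouredEnds≤ends u c (e , x) = +-mono-≤ (ind-∧≤ˡ (src e == u) _) (ind-∧≤ˡ (dst e == u) _)

colouredEnds-split : ∀ u (ce : Coloured n) → colouredEnds u true ce + colouredEnds u false ce ≡ ends u (proj₁ ce)
colouredEnds-split u (e , x) = trans
  (interchange (ind (src e == u ∧ (x ==ᵇ true))) (ind (dst e == u ∧ ((x xor twisted e) ==ᵇ true))) _ _)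
  (cong₂ _+_ (ind-∧-==ᵇ-split (src e == u) x) (ind-∧-==ᵇ-split (dst e == u) (x xor twisted e)))

ColouringOf : List (Coloured n) → List (Edge n) → Set
ColouringOf cs E = map proj₁ cs ↭ E

colourDeg-split : ∀ u (cs : List (Coloured n)) {E} → ColouringOf cs E →
  colourDeg u true cs + colourDeg u false cs ≡ deg u E
colourDeg-split u cs {E} cs↭E = begin
  colourDeg u true cs + colourDeg u false cs                  ≡⟨ sumMap-distrib-+ _ _ cs ⟨
  sumMap (λ ce → colouredEnds u true ce + colouredEnds u false ce) cs ≡⟨ sumMap-cong cs (colouredEnds-split u) ⟩
  sumMap (ends u ∘ proj₁) cs                                  ≡⟨ sumMap-map (ends u) proj₁ cs ⟨
  deg u (map proj₁ cs)                                        ≡⟨ sumMap-↭ (ends u) cs↭E ⟩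
  deg u E                                                     ∎
  where open ≡-Reasoning

incident : Fin n → Edge n → Bool
incident w e = src e == w ∨ dst e == w

other : Fin n → Edge n → Fin n
other w e = if src e == w then dst e else src e

withFarColour : Fin n → Edge n → Bool → Bool
withFarColour w e κ = if src e == w then κ xor twisted e else κ

-- Twisted so that when e and f take their far-end colours from the new edge, their two ends at w
-- get opposite colours.
splitOff : Fin n → Edge n → Edge n → Edge n
splitOff w e f = edge (other w e) (other w f) (not (twisted e xor twisted f)) false

ends-incident : ∀ w u (e : Edge n) → incident w e ≡ true →
  ends u e ≡ ind (w == u) + ind (other w e == u)
ends-incident w u e inc with src e == w in src≡w
... | true  rewrite does⇒ (src e ≟ w) src≡w = refl
... | false rewrite does⇒ (dst e ≟ w) inc   = +-comm (ind (src e == u)) (ind (w == u))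

colouredEnds-withFarColour : ∀ w u c (e : Edge n) κ → incident w e ≡ true →
  colouredEnds u c (e , withFarColour w e κ)
    ≡ ind (w == u ∧ ((κ xor twisted e) ==ᵇ c)) + ind (other w e == u ∧ (κ ==ᵇ c))
colouredEnds-withFarColour w u c e κ inc with src e == w in src≡w
... | true  rewrite does⇒ (src e ≟ w) src≡w | xor-assoc κ (twisted e) (twisted e) | xor-same (twisted e) | xor-identityʳ κ = refl
... | false rewrite does⇒ (dst e ≟ w) inc =
  +-comm (ind (src e == u ∧ (κ ==ᵇ c))) (ind (w == u ∧ ((κ xor twisted e) ==ᵇ c)))

splitOff-ends : ∀ w u (e f : Edge n) → incident w e ≡ true → incident w f ≡ true →
  ends u e + ends u f ≡ ends u (splitOff w e f) + (ind (w == u) + ind (w == u))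
splitOff-ends w u e f e-inc f-inc =
  trans (cong₂ _+_ (ends-incident w u e e-inc) (ends-incident w u f f-inc))
        (+-shuffle (ind (w == u)) (ind (other w e == u)) (ind (w == u)) (ind (other w f == u)))
  where
  +-shuffle : ∀ a b c d → (a + b) + (c + d) ≡ (b + d) + (a + c)
  +-shuffle = solve-∀

splitOff-colouredEnds : ∀ w u c (e f : Edge n) κ → incident w e ≡ true → incident w f ≡ true →
  colouredEnds u c (e , withFarColour w e κ)
    + colouredEnds u c (f , withFarColour w f (κ xor not (twisted e xor twisted f)))
  ≡ colouredEnds u c (splitOff w e f , κ) + ind (w == u)
splitOff-colouredEnds w u c e f κ e-inc f-inc = begin
  colouredEnds u c (e , withFarColour w e κ) + colouredEnds u c (f , withFarColour w f κ′)
    ≡⟨ cong₂ _+_ (colouredEnds-withFarColour w u c e κ e-inc) (colouredEnds-withFarColour w u c f κ′ f-inc) ⟩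
  (atW-e + far-e) + (atW-f + far-f)
    ≡⟨ +-shuffle atW-e far-e atW-f far-f ⟩
  (far-e + far-f) + (atW-e + atW-f)
    ≡⟨ cong (far-e + far-f +_) (subst (λ y → atW-e + ind (w == u ∧ (y ==ᵇ c)) ≡ ind (w == u))
                                       (sym (opposite κ (twisted e) (twisted f)))
                                       (ind-∧-==ᵇ-not (w == u) (κ xor twisted e) c)) ⟩
  colouredEnds u c (splitOff w e f , κ) + ind (w == u) ∎
  where
  open ≡-Reasoning
  κ′ = κ xor not (twisted e xor twisted f)
  atW-e = ind (w == u ∧ ((κ xor twisted e) ==ᵇ c))
  atW-f = ind (w == u ∧ ((κ′ xor twisted f) ==ᵇ c))
  far-e = ind (other w e == u ∧ (κ ==ᵇ c))
  far-f = ind (other w f == u ∧ (κ′ ==ᵇ c))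
  +-shuffle : ∀ a b c d → (a + b) + (c + d) ≡ (b + d) + (a + c)
  +-shuffle = solve-∀
  opposite : ∀ k s t → (k xor not (s xor t)) xor t ≡ not (k xor s)
  opposite true  true  true  = refl
  opposite true  true  false = refl
  opposite true  false true  = refl
  opposite true  false false = refl
  opposite false true  true  = refl
  opposite false true  false = refl
  opposite false false true  = refl
  opposite false false false = refl

-- 2 * colourDeg u c − deg u is the excess of colour c over the other colour at u; the two
-- excesses are compared with the subtractions moved across.
SameExcess : List (Coloured n) → List (Edge n) → List (Coloured n) → List (Edge n) → Set
SameExcess {n} cs E cs′ E′ =
  ∀ (u : Fin n) c → 2 * colourDeg u c cs + deg u E′ ≡ 2 * colourDeg u c cs′ + deg u E

Lifts : List (Edge n) → List (Edge n) → Set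
Lifts {n} E E′ = ∀ (cs′ : List (Coloured n)) → ColouringOf cs′ E′ →
  ∃[ cs ] ColouringOf cs E × SameExcess cs E cs′ E′

Lifts-refl : (E : List (Edge n)) → Lifts E E
Lifts-refl E cs coloured = cs , coloured , λ u c → refl

Lifts-trans : ∀ {E E′ E″ : List (Edge n)} → Lifts E E′ → Lifts E′ E″ → Lifts E E″
Lifts-trans {E = E} {E′} {E″} L L′ cs″ coloured″ =
  let (cs′ , coloured′ , same′) = L′ cs″ coloured″
      (cs , coloured , same) = L cs′ coloured′
  in cs , coloured , λ u c → combine (2 * colourDeg u c cs) (deg u E′) _ (deg u E) (deg u E″) _ (same u c) (same′ u c)
  where
  combine : ∀ a b c d e f → a + b ≡ c + d → c + e ≡ f + b → a + e ≡ f + d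
  combine a b c d e f eq eq′ = +-cancelʳ-≡ b (a + e) (f + d) (begin
    a + e + b   ≡⟨ xy∙z≈xz∙y a e b ⟩
    a + b + e   ≡⟨ cong (_+ e) eq ⟩
    c + d + e   ≡⟨ xy∙z≈xz∙y c d e ⟩
    c + e + d   ≡⟨ cong (_+ d) eq′ ⟩
    f + b + d   ≡⟨ xy∙z≈xz∙y f b d ⟩
    f + d + b   ∎)
    where open ≡-Reasoning

split-excess-arith : ∀ X Y Z I R de df dg D → X + Y ≡ Z + I → de + df ≡ dg + (I + I) →
  2 * (X + (Y + R)) + (dg + D) ≡ 2 * (Z + R) + (de + (df + D))
split-excess-arith X Y Z I R de df dg D eqT eqD = begin
  2 * (X + (Y + R)) + (dg + D)          ≡⟨ solve₁ X Y R dg D ⟩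
  2 * (X + Y) + (2 * R + dg + D)        ≡⟨ cong (λ s → 2 * s + (2 * R + dg + D)) eqT ⟩
  2 * (Z + I) + (2 * R + dg + D)        ≡⟨ solve₂ Z I R dg D ⟩
  2 * Z + 2 * R + (dg + (I + I)) + D    ≡⟨ cong (λ s → 2 * Z + 2 * R + s + D) eqD ⟨
  2 * Z + 2 * R + (de + df) + D         ≡⟨ solve₃ Z R de df D ⟩
  2 * (Z + R) + (de + (df + D))         ∎
  where
  open ≡-Reasoning
  solve₁ : ∀ X Y R dg D → 2 * (X + (Y + R)) + (dg + D) ≡ 2 * (X + Y) + (2 * R + dg + D)
  solve₁ = solve-∀
  solve₂ : ∀ Z I R dg D → 2 * (Z + I) + (2 * R + dg + D) ≡ 2 * Z + 2 * R + (dg + (I + I)) + D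
  solve₂ = solve-∀
  solve₃ : ∀ Z R de df D → 2 * Z + 2 * R + (de + df) + D ≡ 2 * (Z + R) + (de + (df + D))
  solve₃ = solve-∀

record SplitAt (w : Fin n) (E : List (Edge n)) : Set where
  constructor splitAt
  field
    e f    : Edge n
    rest   : List (Edge n)
    E↭     : E ↭ e ∷ f ∷ rest
    e-inc  : incident w e ≡ true
    f-inc  : incident w f ≡ true

  result : List (Edge n)
  result = splitOff w e f ∷ rest

  result-length : suc (length result) ≡ length E
  result-length = sym (↭-length E↭)

  result-deg : ∀ u → deg u result + (ind (w == u) + ind (w == u)) ≡ deg u E
  result-deg u = begin
    ends u (splitOff w e f) + deg u rest + (ind (w == u) + ind (w == u))
      ≡⟨ xy∙z≈xz∙y (ends u (splitOff w e f)) (deg u rest) _ ⟩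
    ends u (splitOff w e f) + (ind (w == u) + ind (w == u)) + deg u rest
      ≡⟨ cong (_+ deg u rest) (splitOff-ends w u e f e-inc f-inc) ⟨
    ends u e + ends u f + deg u rest
      ≡⟨ +-assoc (ends u e) (ends u f) (deg u rest) ⟩
    deg u (e ∷ f ∷ rest)
      ≡⟨ sumMap-↭ (ends u) E↭ ⟨
    deg u E ∎
    where open ≡-Reasoning

  result-deg-≤ : ∀ u → deg u result ≤ deg u E
  result-deg-≤ u = subst (deg u result ≤_) (result-deg u) (m≤m+n _ _)

  result-lifts : Lifts E result
  result-lifts cs′ coloured′ with ↭-map-inv proj₁ coloured′
  ... | (g , κ) ∷ cs-rest , eq , cs′↭ = cs , coloured , same
    where
    κ′ = κ xor not (twisted e xor twisted f)
    cs = (e , withFarColour w e κ) ∷ (f , withFarColour w f κ′) ∷ cs-rest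
    g≡ : g ≡ splitOff w e f
    g≡ = sym (proj₁ (∷-injective eq))
    coloured : ColouringOf cs E
    coloured = ↭-trans (prep e (prep f (↭-reflexive (sym (proj₂ (∷-injective eq)))))) (↭-sym E↭)
    same : SameExcess cs E cs′ result
    same u c = begin
      2 * (X + (Y + R)) + (ends u (splitOff w e f) + deg u rest)
        ≡⟨ split-excess-arith X Y (colouredEnds u c (splitOff w e f , κ)) (ind (w == u)) R
                 (ends u e) (ends u f) (ends u (splitOff w e f)) (deg u rest)
                 (splitOff-colouredEnds w u c e f κ e-inc f-inc) (splitOff-ends w u e f e-inc f-inc) ⟩
      2 * (colouredEnds u c (splitOff w e f , κ) + R) + deg u (e ∷ f ∷ rest)
        ≡⟨ cong₂ (λ g D → 2 * (colouredEnds u c (g , κ) + R) + D) (sym g≡) (sumMap-↭ (ends u) (↭-sym E↭)) ⟩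
      2 * colourDeg u c ((g , κ) ∷ cs-rest) + deg u E
        ≡⟨ cong (λ T → 2 * T + deg u E) (sumMap-↭ (colouredEnds u c) cs′↭) ⟨
      2 * colourDeg u c cs′ + deg u E ∎
      where
      open ≡-Reasoning
      X = colouredEnds u c (e , withFarColour w e κ)
      Y = colouredEnds u c (f , withFarColour w f κ′)
      R = colourDeg u c cs-rest

record Reduction (E E′ : List (Edge n)) : Set where
  constructor reduction
  field
    deg-≤ : ∀ u → deg u E′ ≤ deg u E
    lifts : Lifts E E′
open Reduction public

Reduction-refl : (E : List (Edge n)) → Reduction E E
Reduction-refl E = reduction (λ u → ≤-refl) (Lifts-refl E)

Reduction-trans : ∀ {E E′ E″ : List (Edge n)} → Reduction E E′ → Reduction E′ E″ → Reduction E E″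
Reduction-trans r r′ = reduction (λ u → ≤-trans (deg-≤ r′ u) (deg-≤ r u)) (Lifts-trans (lifts r) (lifts r′))

SplitAt-reduction : ∀ {w} {E : List (Edge n)} (s : SplitAt w E) → Reduction E (SplitAt.result s)
SplitAt-reduction s = reduction (SplitAt.result-deg-≤ s) (SplitAt.result-lifts s)

SplitAt-length : ∀ {w} {E : List (Edge n)} (s : SplitAt w E) → ∀ {k} → length E ≤ suc k →
  length (SplitAt.result s) ≤ k
SplitAt-length s len = ≤-pred (subst (_≤ _) (sym (SplitAt.result-length s)) len)

deg-≡0 : ∀ w (E : List (Edge n)) → sumMap (ind ∘ incident w) E ≡ 0 → deg w E ≡ 0
deg-≡0 w E none = n≤0⇒n≡0 (begin
  deg w E                               ≤⟨ sumMap-mono-≤ E (λ e → ind+ind≤2*ind-∨ (src e == w) (dst e == w)) ⟩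
  sumMap (λ e → 2 * ind (incident w e)) E ≡⟨ sumMap-distribˡ-* 2 (ind ∘ incident w) E ⟩
  2 * sumMap (ind ∘ incident w) E       ≡⟨ cong (2 *_) none ⟩
  0                                     ∎)
  where open ≤-Reasoning

splitAt-of-3≤deg : ∀ w (E : List (Edge n)) → 3 ≤ deg w E → SplitAt w E
splitAt-of-3≤deg w E 3≤ with find-↭ (incident w) E
... | inj₂ none = contradiction (deg-≡0 w E none) (λ deg≡0 → <⇒≢ (≤-trans (s≤s z≤n) 3≤) (sym deg≡0))
... | inj₁ (e , R₁ , e-inc , E↭) with find-↭ (incident w) R₁
...   | inj₂ none = contradiction 3≤ (<⇒≱ (s≤s (begin
        deg w E             ≡⟨ sumMap-↭ (ends w) E↭ ⟩
        ends w e + deg w R₁ ≡⟨ cong (ends w e +_) (deg-≡0 w R₁ none) ⟩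
        ends w e + 0        ≡⟨ +-identityʳ _ ⟩
        ends w e            ≤⟨ ends≤2 w e ⟩
        2                   ∎)))
  where open ≤-Reasoning
...   | inj₁ (f , R , f-inc , R₁↭) = splitAt e f R (↭-trans E↭ (prep e R₁↭)) e-inc f-inc

reduceDeg≤2 : (E : List (Edge n)) → ∃[ E′ ] (∀ u → deg u E′ ≤ 2) × Reduction E E′
reduceDeg≤2 E = go (length E) E ≤-refl
  where
  go : ∀ k E → length E ≤ k → ∃[ E′ ] (∀ u → deg u E′ ≤ 2) × Reduction E E′
  go k E len with any? (λ w → 3 ≤? deg w E)
  ... | no none      = E , (λ u → ≤-pred (≰⇒> (λ 3≤ → none (u , 3≤)))) , Reduction-refl E
  ... | yes (w , 3≤) = continue k len (splitAt-of-3≤deg w E 3≤)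
    where
    continue : ∀ k → length E ≤ k → SplitAt w E → ∃[ E′ ] (∀ u → deg u E′ ≤ 2) × Reduction E E′
    continue zero    len s = contradiction (subst (_≤ 0) (sym (SplitAt.result-length s)) len) λ ()
    continue (suc k) len s =
      let (E′ , ≤2 , r) = go k (SplitAt.result s) (SplitAt-length s len)
      in E′ , ≤2 , Reduction-trans (SplitAt-reduction s) r

isLoopAt : Fin n → Edge n → Bool
isLoopAt t e = src e == t ∧ dst e == t

isLinkAt : Fin n → Edge n → Bool
isLinkAt t e = (src e == t) xor (dst e == t)

loops links : Fin n → List (Edge n) → ℕ
loops t = sumMap (ind ∘ isLoopAt t)
links t = sumMap (ind ∘ isLinkAt t)

ends-links-loops : ∀ t (e : Edge n) → ends t e ≡ ind (isLinkAt t e) + 2 * ind (isLoopAt t e)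
ends-links-loops t e with src e == t | dst e == t
... | true  | true  = refl
... | true  | false = refl
... | false | true  = refl
... | false | false = refl

deg-links-loops : ∀ t (E : List (Edge n)) → deg t E ≡ links t E + 2 * loops t E
deg-links-loops t E = begin
  deg t E                                                         ≡⟨ sumMap-cong E (ends-links-loops t) ⟩
  sumMap (λ e → ind (isLinkAt t e) + 2 * ind (isLoopAt t e)) E    ≡⟨ sumMap-distrib-+ _ _ E ⟩
  links t E + sumMap (λ e → 2 * ind (isLoopAt t e)) E             ≡⟨ cong (links t E +_) (sumMap-distribˡ-* 2 _ E) ⟩
  links t E + 2 * loops t E                                       ∎
  where open ≡-Reasoning

isLinkAt⇒incident : ∀ t (e : Edge n) → isLinkAt t e ≡ true → incident t e ≡ true
isLinkAt⇒incident t e link with src e == t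
... | true  = refl
... | false = link

isLoopAt⇒incident : ∀ t (e : Edge n) → isLoopAt t e ≡ true → incident t e ≡ true
isLoopAt⇒incident t e loop with src e == t
... | true  = refl

isLinkAt⇒other : ∀ t (e : Edge n) → isLinkAt t e ≡ true → other t e == t ≡ false
isLinkAt⇒other t e link with src e == t in src≡t | dst e == t in dst≡t
... | true  | false = dst≡t
... | false | true  = src≡t

isLoopAt⇒other : ∀ t (e : Edge n) → isLoopAt t e ≡ true → other t e == t ≡ true
isLoopAt⇒other t e loop with src e == t | dst e == t in dst≡t
... | true | true = dst≡t

LinkedOrLoopless : Fin n → List (Edge n) → Set
LinkedOrLoopless t E = loops t E ≡ 0 ⊎ 1 ≤ links t E

isLinkAt⇒¬isLoopAt : ∀ t (e : Edge n) → isLinkAt t e ≡ true → isLoopAt t e ≡ false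
isLinkAt⇒¬isLoopAt t e link with src e == t | dst e == t
... | true  | false = refl
... | false | _     = refl

unlinked⇒deg≡0 : ∀ t (E : List (Edge n)) → LinkedOrLoopless t E → links t E ≡ 0 → deg t E ≡ 0
unlinked⇒deg≡0 t E inv none = begin
  deg t E                   ≡⟨ deg-links-loops t E ⟩
  links t E + 2 * loops t E ≡⟨ cong₂ (λ l o → l + 2 * o) none (loops≡0 inv) ⟩
  0                         ∎
  where
  open ≡-Reasoning
  loops≡0 : LinkedOrLoopless t E → loops t E ≡ 0
  loops≡0 (inj₁ loopless) = loopless
  loops≡0 (inj₂ linked)   = contradiction (subst (1 ≤_) none linked) λ ()

lone-link⇒deg≡1 : ∀ t e (R : List (Edge n)) → isLinkAt t e ≡ true → sumMap (ind ∘ incident t) R ≡ 0 →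
  deg t (e ∷ R) ≡ 1
lone-link⇒deg≡1 t e R link none = begin
  ends t e + deg t R                              ≡⟨ cong₂ _+_ (ends-links-loops t e) (deg-≡0 t R none) ⟩
  ind (isLinkAt t e) + 2 * ind (isLoopAt t e) + 0
    ≡⟨ cong₂ (λ a b → ind a + 2 * ind b + 0) link (isLinkAt⇒¬isLoopAt t e link) ⟩
  1                                               ∎
  where open ≡-Reasoning

-- Splitting a link with a loop leaves a link; splitting a link with a non-loop creates no loop.
splitAtLink : ∀ t (E : List (Edge n)) → LinkedOrLoopless t E → 2 ≤ deg t E →
  Σ (SplitAt t E) (LinkedOrLoopless t ∘ SplitAt.result)
splitAtLink t E inv 2≤ with find-↭ (isLinkAt t) E
... | inj₂ none = contradiction 2≤ (<⇒≱ (s≤s (≤-trans (≤-reflexive (unlinked⇒deg≡0 t E inv none)) z≤n)))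
... | inj₁ (e , R₁ , e-link , E↭) with find-↭ (isLoopAt t) R₁
...   | inj₁ (f , R , f-loop , R₁↭) =
  splitAt e f R (↭-trans E↭ (prep e R₁↭)) (isLinkAt⇒incident t e e-link) (isLoopAt⇒incident t f f-loop) ,
  inj₂ (subst (λ b → 1 ≤ ind b + links t R)
              (sym (cong₂ _xor_ (isLinkAt⇒other t e e-link) (isLoopAt⇒other t f f-loop)))
              (s≤s z≤n))
...   | inj₂ noLoops with find-↭ (incident t) R₁
...     | inj₂ none = contradiction 2≤
          (<⇒≱ (s≤s (≤-reflexive (trans (sumMap-↭ (ends t) E↭) (lone-link⇒deg≡1 t e R₁ e-link none)))))
...     | inj₁ (f , R , f-inc , R₁↭) =
  splitAt e f R (↭-trans E↭ (prep e R₁↭)) (isLinkAt⇒incident t e e-link) f-inc ,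
  inj₁ (cong₂ _+_ (cong (λ b → ind (b ∧ (other t f == t))) (isLinkAt⇒other t e e-link))
                  (m+n≡0⇒n≡0 (ind (isLoopAt t f)) (trans (sym (sumMap-↭ (ind ∘ isLoopAt t) R₁↭)) noLoops)))

_∈ᵇ_ : Fin n → List (Fin n) → Bool
v ∈ᵇ vs = does (Any.any? (v ≟_) vs)

outEnd : List (Fin n) → Fin n → Edge n → Bool
outEnd done t e = (src e == t ∧ not (dst e == t) ∧ not (dst e ∈ᵇ done))
                ∨ (dst e == t ∧ not (src e == t) ∧ not (src e ∈ᵇ done))

outDeg : List (Fin n) → Fin n → List (Edge n) → ℕ
outDeg done t = sumMap (ind ∘ outEnd done t)

outDeg≤links : ∀ done t (E : List (Edge n)) → outDeg done t E ≤ links t E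
outDeg≤links done t E = sumMap-mono-≤ E λ e →
  ind-outEnd≤ (src e == t) (dst e == t) (not (dst e ∈ᵇ done)) (not (src e ∈ᵇ done))
  where
  ind-outEnd≤ : ∀ a b c d → ind ((a ∧ not b ∧ c) ∨ (b ∧ not a ∧ d)) ≤ ind (a xor b)
  ind-outEnd≤ true  true  c     d     = z≤n
  ind-outEnd≤ true  false c     d     = ind≤1 (c ∨ false)
  ind-outEnd≤ false true  c     d     = ind≤1 d
  ind-outEnd≤ false false c     d     = z≤n

outEnd-incident : ∀ {w t′ done} (e : Edge n) → incident w e ≡ true → w ∈ done → t′ ∉ done →
  outEnd done t′ e ≡ false
outEnd-incident {w = w} {t′} {done} e inc w∈ t′∉ =
  outEnd-at inc (dec-false (w ≟ t′) (λ { refl → t′∉ w∈ })) (dec-true (Any.any? (w ≟_) done) w∈)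
  where
  outEnd-at : incident w e ≡ true → w == t′ ≡ false → w ∈ᵇ done ≡ true → outEnd done t′ e ≡ false
  outEnd-at inc w==t′ w∈ᵇ with src e == w in src≡w
  ... | true  rewrite does⇒ (src e ≟ w) src≡w | w==t′ | w∈ᵇ = ∧-zeroʳ (dst e == t′)
  ... | false rewrite does⇒ (dst e ≟ w) inc    | w==t′ | w∈ᵇ = trans (∨-identityʳ _) (∧-zeroʳ (src e == t′))

OutDegPreserved : Fin n → List (Edge n) → List (Edge n) → Set
OutDegPreserved t E E′ = ∀ done t′ → t ∈ done → t′ ∉ done → outDeg done t′ E ≤ outDeg done t′ E′

SplitAt-outDeg : ∀ {w} {E : List (Edge n)} (s : SplitAt w E) → OutDegPreserved w E (SplitAt.result s)
SplitAt-outDeg {w = w} {E} (splitAt e f rest E↭ e-inc f-inc) done t′ w∈ t′∉ = begin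
  outDeg done t′ E                ≡⟨ sumMap-↭ (ind ∘ outEnd done t′) E↭ ⟩
  ind (outEnd done t′ e) + (ind (outEnd done t′ f) + outDeg done t′ rest)
    ≡⟨ cong₂ (λ a b → ind a + (ind b + outDeg done t′ rest))
             (outEnd-incident e e-inc w∈ t′∉) (outEnd-incident f f-inc w∈ t′∉) ⟩
  outDeg done t′ rest             ≤⟨ m≤n+m _ _ ⟩
  outDeg done t′ (splitOff w e f ∷ rest) ∎
  where open ≤-Reasoning

reduceAt : ∀ t (E : List (Edge n)) → LinkedOrLoopless t E →
  ∃[ E′ ] deg t E′ ≤ 1 × Reduction E E′ × OutDegPreserved t E E′
reduceAt t E inv = go (length E) E ≤-refl inv
  where
  go : ∀ k E → length E ≤ k → LinkedOrLoopless t E →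
    ∃[ E′ ] deg t E′ ≤ 1 × Reduction E E′ × OutDegPreserved t E E′
  go k E len inv with deg t E ≤? 1
  ... | yes ≤1 = E , ≤1 , Reduction-refl E , λ _ _ _ _ → ≤-refl
  ... | no ≰1  = continue k len (splitAtLink t E inv (≰⇒> ≰1))
    where
    continue : ∀ k → length E ≤ k →
      Σ (SplitAt t E) (LinkedOrLoopless t ∘ SplitAt.result) →
      ∃[ E′ ] deg t E′ ≤ 1 × Reduction E E′ × OutDegPreserved t E E′
    continue zero    len (s , _) = contradiction (subst (_≤ 0) (sym (SplitAt.result-length s)) len) λ ()
    continue (suc k) len (s , inv′) =
      let (E′ , ≤1 , r , pres) = go k (SplitAt.result s) (SplitAt-length s len) inv′
      in E′ , ≤1 , Reduction-trans (SplitAt-reduction s) r ,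
         λ done t′ t∈ t′∉ → ≤-trans (SplitAt-outDeg s done t′ t∈ t′∉) (pres done t′ t∈ t′∉)

-- Each scheduled vertex still has an edge to a vertex not scheduled before it; this survives
-- the reductions at the earlier vertices and lets the reduction at it start.
Schedule : List (Fin n) → List (Fin n) → List (Edge n) → Set
Schedule done []       E = ⊤
Schedule done (t ∷ ts) E = t ∉ done × 1 ≤ outDeg done t E × Schedule (t ∷ done) ts E

Schedule-preserved : ∀ {t} {E E′ : List (Edge n)} done ts → t ∈ done → OutDegPreserved t E E′ →
  Schedule done ts E → Schedule done ts E′
Schedule-preserved done []        t∈ pres tt = tt
Schedule-preserved done (t′ ∷ ts) t∈ pres (t′∉ , out , sched) =
  t′∉ , ≤-trans out (pres done t′ t∈ t′∉) , Schedule-preserved (t′ ∷ done) ts (there t∈) pres sched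

reduceScheduled : ∀ done ts (E : List (Edge n)) → Schedule done ts E →
  ∃[ E′ ] (∀ t → t ∈ ts → deg t E′ ≤ 1) × Reduction E E′
reduceScheduled done []       E tt = E , (λ t ()) , Reduction-refl E
reduceScheduled done (t ∷ ts) E (t∉ , out , sched) =
  let (E₁ , ≤1 , r₁ , pres) = reduceAt t E (inj₂ (≤-trans out (outDeg≤links done t E)))
      (E′ , ≤1s , r)        = reduceScheduled (t ∷ done) ts E₁
                                (Schedule-preserved (t ∷ done) ts (here refl) pres sched)
  in E′ , (λ { t′ (here refl) → ≤-trans (deg-≤ r t′) ≤1 ; t′ (there t′∈) → ≤1s t′ t′∈ }) ,
     Reduction-trans r₁ r

monochrome : List (Edge n) → List (Coloured n)
monochrome = map (_, false)

monochrome-colouring : (E : List (Edge n)) → ColouringOf (monochrome E) E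
monochrome-colouring E = ↭-reflexive (trans (sym (map-∘ E)) (map-id E))

colourDeg-monochrome : ∀ u c (E : List (Edge n)) → colourDeg u c (monochrome E) ≤ deg u E
colourDeg-monochrome u c E = begin
  colourDeg u c (monochrome E)          ≡⟨ sumMap-map (colouredEnds u c) (_, false) E ⟩
  sumMap (λ e → colouredEnds u c (e , false)) E ≤⟨ sumMap-mono-≤ E (λ e → colouredEnds≤ends u c (e , false)) ⟩
  deg u E                               ∎
  where open ≤-Reasoning

excess-≤ : ∀ {T D d t} b → 2 * T + d ≡ 2 * t + D → t ≤ d → d ≤ b → 2 * T ≤ D + b
excess-≤ {T} {D} {d} {t} b eq t≤d d≤b = +-cancelʳ-≤ d (2 * T) (D + b) (begin
  2 * T + d   ≡⟨ eq ⟩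
  2 * t + D   ≤⟨ +-monoˡ-≤ D (*-monoʳ-≤ 2 t≤d) ⟩
  2 * d + D   ≡⟨ rearrange d D ⟩
  D + d + d   ≤⟨ +-monoˡ-≤ d (+-monoʳ-≤ D d≤b) ⟩
  D + b + d   ∎)
  where
  open ≤-Reasoning
  rearrange : ∀ d D → 2 * d + D ≡ D + d + d
  rearrange = solve-∀

excess-even : ∀ {T D d t} k → 2 * T + d ≡ 2 * t + D → t ≤ d → d ≤ 1 → D ≡ 2 * k → 2 * T ≡ D
excess-even {T} {D} {zero}      {zero} k eq t≤d d≤1 D≡ = trans (sym (+-identityʳ (2 * T))) eq
excess-even {T} {D} {suc zero}  {t}    k eq t≤d d≤1 D≡ =
  contradiction (trans (*-distribˡ-+ 2 t k) (trans (cong (2 * t +_) (sym D≡)) (trans (sym eq) (+-comm (2 * T) 1))))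
                (even≢odd (t + k) T)
excess-even {d = suc (suc d)} k eq t≤d (s≤s ()) D≡

record BalancedColouring (ts : List (Fin n)) (E : List (Edge n)) : Set where
  field
    colouring      : List (Coloured n)
    isColouring    : ColouringOf colouring E
    excess≤2       : ∀ u c → 2 * colourDeg u c colouring ≤ deg u E + 2
    excess≤1       : ∀ u c → u ∈ ts → 2 * colourDeg u c colouring ≤ deg u E + 1
    even⇒balanced  : ∀ u c k → u ∈ ts → deg u E ≡ 2 * k → 2 * colourDeg u c colouring ≡ deg u E

balancedColouring : ∀ ts (E : List (Edge n)) → Schedule [] ts E → BalancedColouring ts E
balancedColouring ts E sched = record
  { colouring     = cs
  ; isColouring   = coloured
  ; excess≤2      = λ u c → excess-≤ {T = colourDeg u c cs} {D = deg u E} 2 (same u c) (mono u c) (≤2 u)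
  ; excess≤1      = λ u c u∈ → excess-≤ {T = colourDeg u c cs} {D = deg u E} 1 (same u c) (mono u c) (≤1 u u∈)
  ; even⇒balanced = λ u c k u∈ → excess-even {T = colourDeg u c cs} {D = deg u E} k (same u c) (mono u c) (≤1 u u∈)
  }
  where
  reduced₁ = reduceScheduled [] ts E sched
  E₁ = proj₁ reduced₁
  reduced₂ = reduceDeg≤2 E₁
  E₂ = proj₁ reduced₂
  ≤2 : ∀ u → deg u E₂ ≤ 2
  ≤2 = proj₁ (proj₂ reduced₂)
  r : Reduction E E₂
  r = Reduction-trans (proj₂ (proj₂ reduced₁)) (proj₂ (proj₂ reduced₂))
  ≤1 : ∀ t → t ∈ ts → deg t E₂ ≤ 1
  ≤1 t t∈ = ≤-trans (deg-≤ (proj₂ (proj₂ reduced₂)) t) (proj₁ (proj₂ reduced₁) t t∈)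
  lifted = lifts r (monochrome E₂) (monochrome-colouring E₂)
  cs = proj₁ lifted
  coloured = proj₁ (proj₂ lifted)
  same = proj₂ (proj₂ lifted)
  mono : ∀ u c → colourDeg u c (monochrome E₂) ≤ deg u E₂
  mono u c = colourDeg-monochrome u c E₂

-- A graph with a Hamiltonian path

module HamiltonianPath {m : ℕ} (G : Graph (5 + m)) (path : Traceable G) where

  V : Set
  V = Fin (5 + m)

  vertexAt : Fin (5 + m) → V
  vertexAt i = proj₁ path ⟨$⟩ʳ i

  index : V → ℕ
  index u = toℕ (proj₁ path ⟨$⟩ˡ u)

  index-vertexAt : ∀ i → index (vertexAt i) ≡ toℕ i
  index-vertexAt i = cong toℕ (inverseˡ (proj₁ path))

  index-injective : ∀ {u v} → index u ≡ index v → u ≡ v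
  index-injective {u} {v} eq = begin
    u                                        ≡⟨ inverseʳ (proj₁ path) ⟨
    proj₁ path ⟨$⟩ʳ (proj₁ path ⟨$⟩ˡ u)      ≡⟨ cong (proj₁ path ⟨$⟩ʳ_) (toℕ-injective eq) ⟩
    proj₁ path ⟨$⟩ʳ (proj₁ path ⟨$⟩ˡ v)      ≡⟨ inverseʳ (proj₁ path) ⟩
    v                                        ∎
    where open ≡-Reasoning

  index<n : ∀ u → index u < 5 + m
  index<n u = toℕ<n (proj₁ path ⟨$⟩ˡ u)

  vertexWithIndex : ∀ k → k < 5 + m → ∃ λ u → index u ≡ k
  vertexWithIndex k k<n = vertexAt (fromℕ< k<n) , trans (index-vertexAt _) (toℕ-fromℕ< k<n)

  follows : V → V → Bool
  follows u v = does (index v ℕ.≟ suc (index u))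

  follows⇒adj : ∀ u v → follows u v ≡ true → adj G u v ≡ true
  follows⇒adj u v uv = subst₂ (λ a b → adj G a b ≡ true) (inverseʳ (proj₁ path)) (inverseʳ (proj₁ path))
    (proj₂ path _ _ (does⇒ (index v ℕ.≟ suc (index u)) uv))

  pathAdj : V → V → Bool
  pathAdj u v = follows u v ∨ follows v u

  pathAdj-sym : ∀ u v → pathAdj u v ≡ pathAdj v u
  pathAdj-sym u v = ∨-comm (follows u v) (follows v u)

  pathAdj⇒adj : ∀ u v → pathAdj u v ≡ true → adj G u v ≡ true
  pathAdj⇒adj u v uv with follows u v in fwd
  ... | true  = follows⇒adj u v fwd
  ... | false = trans (Graph.sym G u v) (follows⇒adj v u uv)

  isChord : V → V → Bool
  isChord u v = adj G u v ∧ not (pathAdj u v)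

  isChord-sym : ∀ u v → isChord u v ≡ isChord v u
  isChord-sym u v = cong₂ (λ a b → a ∧ not b) (Graph.sym G u v) (pathAdj-sym u v)

  isChord-irrefl : ∀ u → isChord u u ≡ false
  isChord-irrefl u = cong (_∧ not (pathAdj u u)) (Graph.irrefl G u)

  pathDeg chordDeg : V → ℕ
  pathDeg u  = count (pathAdj u)
  chordDeg u = count (isChord u)

  degree≡pathDeg+chordDeg : ∀ u → degree G u ≡ pathDeg u + chordDeg u
  degree≡pathDeg+chordDeg u = begin
    count (adj G u)                                          ≡⟨ count≡sum (adj G u) ⟩
    sum (λ v → ind (adj G u v))                              ≡⟨ sum-cong-≗ split ⟩
    sum (λ v → ind (pathAdj u v) + ind (isChord u v))        ≡⟨ ∑-distrib-+ (ind ∘ pathAdj u) (ind ∘ isChord u) ⟩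
    sum (ind ∘ pathAdj u) + sum (ind ∘ isChord u)
      ≡⟨ cong₂ _+_ (count≡sum (pathAdj u)) (count≡sum (isChord u)) ⟨
    pathDeg u + chordDeg u                                   ∎
    where
    open ≡-Reasoning
    split : ∀ v → ind (adj G u v) ≡ ind (pathAdj u v) + ind (isChord u v)
    split v with pathAdj u v in uv
    ... | true  rewrite pathAdj⇒adj u v uv = refl
    ... | false with adj G u v
    ...   | true  = refl
    ...   | false = refl

  count-follows≤1 : ∀ u → count (follows u) ≤ 1
  count-follows≤1 u = count-≤1 (follows u) λ v w uv uw →
    index-injective (trans (does⇒ (index v ℕ.≟ _) uv) (sym (does⇒ (index w ℕ.≟ _) uw)))

  count-followed≤1 : ∀ u → count (λ v → follows v u) ≤ 1
  count-followed≤1 u = count-≤1 (λ v → follows v u) λ v w vu wu →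
    index-injective (ℕ.suc-injective (trans (sym (does⇒ (index u ℕ.≟ suc (index v)) vu))
                                            (does⇒ (index u ℕ.≟ suc (index w)) wu)))

  pathDeg≤ : ∀ u → pathDeg u ≤ count (follows u) + count (λ v → follows v u)
  pathDeg≤ u = count-∨≤ (follows u) (λ v → follows v u)

  pathDeg≤2 : ∀ u → pathDeg u ≤ 2
  pathDeg≤2 u = ≤-trans (pathDeg≤ u) (+-mono-≤ (count-follows≤1 u) (count-followed≤1 u))

  s₀ q₀ q₁ s₁ : V
  s₀ = vertexAt zero
  q₀ = vertexAt (suc zero)
  q₁ = vertexAt (inject₁ (fromℕ (3 + m)))
  s₁ = vertexAt (fromℕ (4 + m))

  index-s₀ : index s₀ ≡ 0
  index-s₀ = index-vertexAt zero

  index-q₀ : index q₀ ≡ 1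
  index-q₀ = index-vertexAt (suc zero)

  index-q₁ : index q₁ ≡ 3 + m
  index-q₁ = trans (index-vertexAt _) (trans (toℕ-inject₁ (fromℕ (3 + m))) (toℕ-fromℕ (3 + m)))

  index-s₁ : index s₁ ≡ 4 + m
  index-s₁ = trans (index-vertexAt _) (toℕ-fromℕ (4 + m))

  ≢-by-index : ∀ {u v a b} → index u ≡ a → index v ≡ b → ¬ a ≡ b → ¬ u ≡ v
  ≢-by-index iu iv a≢b refl = a≢b (trans (sym iu) iv)

  s₁≢s₀ : ¬ s₁ ≡ s₀
  s₁≢s₀ = ≢-by-index index-s₁ index-s₀ λ ()

  q₀≢s₀ : ¬ q₀ ≡ s₀
  q₀≢s₀ = ≢-by-index index-q₀ index-s₀ λ ()

  q₀≢s₁ : ¬ q₀ ≡ s₁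
  q₀≢s₁ = ≢-by-index index-q₀ index-s₁ λ ()

  q₁≢s₀ : ¬ q₁ ≡ s₀
  q₁≢s₀ = ≢-by-index index-q₁ index-s₀ λ ()

  q₁≢s₁ : ¬ q₁ ≡ s₁
  q₁≢s₁ = ≢-by-index index-q₁ index-s₁ (1+n≢n ∘ sym)

  q₁≢q₀ : ¬ q₁ ≡ q₀
  q₁≢q₀ = ≢-by-index index-q₁ index-q₀ λ ()

  follows-by-index : ∀ u v → index v ≡ suc (index u) → follows u v ≡ true
  follows-by-index u v eq = dec-true (index v ℕ.≟ suc (index u)) eq

  pathDeg-s₀≤1 : pathDeg s₀ ≤ 1
  pathDeg-s₀≤1 = ≤-trans (pathDeg≤ s₀) (+-mono-≤ (count-follows≤1 s₀) (≤-reflexive nothing-before))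
    where
    nothing-before : count (λ v → follows v s₀) ≡ 0
    nothing-before = count-none _ λ v → dec-false (index s₀ ℕ.≟ suc (index v)) λ eq → 0≢1+n (trans (sym index-s₀) eq)

  pathDeg-s₁≤1 : pathDeg s₁ ≤ 1
  pathDeg-s₁≤1 = ≤-trans (pathDeg≤ s₁) (+-mono-≤ (≤-reflexive nothing-after) (count-followed≤1 s₁))
    where
    nothing-after : count (follows s₁) ≡ 0
    nothing-after = count-none _ λ v → dec-false (index v ℕ.≟ suc (index s₁)) λ eq →
      <⇒≢ (index<n v) (trans eq (cong suc index-s₁))

  1≤pathDeg-s₀ : 1 ≤ pathDeg s₀
  1≤pathDeg-s₀ = count-≥1 (pathAdj s₀) q₀
    (cong (_∨ follows q₀ s₀) (follows-by-index s₀ q₀ (trans index-q₀ (cong suc (sym index-s₀)))))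

  1≤pathDeg-s₁ : 1 ≤ pathDeg s₁
  1≤pathDeg-s₁ = count-≥1 (pathAdj s₁) q₁
    (trans (cong (follows s₁ q₁ ∨_) (follows-by-index q₁ s₁ (trans index-s₁ (cong suc (sym index-q₁)))))
           (∨-zeroʳ (follows s₁ q₁)))

  2≤pathDeg-inner : ∀ u k → index u ≡ suc k → suc (suc k) < 5 + m → 2 ≤ pathDeg u
  2≤pathDeg-inner u k idx k+2<n = count-≥2 (pathAdj u) next≢prev
    (cong (_∨ follows next u) (follows-by-index u next (trans next-idx (cong suc (sym idx)))))
    (trans (cong (follows u prev ∨_) (follows-by-index prev u (trans idx (cong suc (sym prev-idx)))))
           (∨-zeroʳ (follows u prev)))
    where
    next = proj₁ (vertexWithIndex (suc (suc k)) k+2<n)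
    next-idx = proj₂ (vertexWithIndex (suc (suc k)) k+2<n)
    prev = proj₁ (vertexWithIndex k (<-trans (n<1+n k) (<-trans (n<1+n (suc k)) k+2<n)))
    prev-idx = proj₂ (vertexWithIndex k (<-trans (n<1+n k) (<-trans (n<1+n (suc k)) k+2<n)))
    next≢prev : ¬ next ≡ prev
    next≢prev = ≢-by-index next-idx prev-idx λ eq → <-irrefl (sym eq) (<-trans (n<1+n k) (n<1+n (suc k)))

  2≤pathDeg : ∀ u → ¬ u ≡ s₀ → ¬ u ≡ s₁ → 2 ≤ pathDeg u
  2≤pathDeg u u≢s₀ u≢s₁ = at (index u) refl
    where
    at : ∀ i → index u ≡ i → 2 ≤ pathDeg u
    at zero    idx = contradiction (index-injective (trans idx (sym index-s₀))) u≢s₀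
    at (suc k) idx = 2≤pathDeg-inner u k idx (s≤s (≤∧≢⇒< (≤-pred (subst (_< 5 + m) idx (index<n u)))
      (λ eq → u≢s₁ (index-injective (trans idx (trans eq (sym index-s₁)))))))

  4≤+chordDeg : MinDegree≥ G 4 → ∀ u {k} → pathDeg u ≤ k → 4 ≤ k + chordDeg u
  4≤+chordDeg md u pathDeg≤k =
    ≤-trans (md u) (≤-trans (≤-reflexive (degree≡pathDeg+chordDeg u)) (+-monoˡ-≤ (chordDeg u) pathDeg≤k))

  2≤chordDeg : MinDegree≥ G 4 → ∀ u → 2 ≤ chordDeg u
  2≤chordDeg md u = +-cancelˡ-≤ 2 2 (chordDeg u) (4≤+chordDeg md u (pathDeg≤2 u))

  3≤chordDeg-s₀ : MinDegree≥ G 4 → 3 ≤ chordDeg s₀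
  3≤chordDeg-s₀ md = +-cancelˡ-≤ 1 3 (chordDeg s₀) (4≤+chordDeg md s₀ pathDeg-s₀≤1)

  3≤chordDeg-s₁ : MinDegree≥ G 4 → 3 ≤ chordDeg s₁
  3≤chordDeg-s₁ md = +-cancelˡ-≤ 1 3 (chordDeg s₁) (4≤+chordDeg md s₁ pathDeg-s₁≤1)

  plain : Edge (5 + m) → Bool
  plain e = not (virtual e) ∧ not (twisted e) ∧ not (src e == dst e)

  joins : V → V → Edge (5 + m) → Bool
  joins u v e = plain e ∧ ((src e == u ∧ dst e == v) ∨ (src e == v ∧ dst e == u))

  joins-sym : ∀ u v e → joins u v e ≡ joins v u e
  joins-sym u v e = cong (plain e ∧_) (∨-comm (src e == u ∧ dst e == v) (src e == v ∧ dst e == u))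

  listedChord : V → V → Bool
  listedChord a b = does (a <? b) ∧ isChord a b

  chordCell : V → V → List (Edge (5 + m))
  chordCell a b = if listedChord a b then edge a b false false ∷ [] else []

  chordRow : V → List (Edge (5 + m))
  chordRow a = concatMap (chordCell a) (allFin _)

  chordList : List (Edge (5 + m))
  chordList = concatMap chordRow (allFin _)

  sumMap-chordList : ∀ f → sumMap f chordList ≡ sum (λ a → sum (λ b → sumMap f (chordCell a b)))
  sumMap-chordList f = begin
    sumMap f chordList
      ≡⟨ sumMap-concatMap f chordRow (allFin _) ⟩
    sumMap (sumMap f ∘ chordRow) (allFin _)
      ≡⟨ sumMap-tabulate (sumMap f ∘ chordRow) (λ a → a) ⟩
    sum (sumMap f ∘ chordRow)
      ≡⟨ sum-cong-≗ (λ a → trans (sumMap-concatMap f (chordCell a) (allFin _))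
                                 (sumMap-tabulate (sumMap f ∘ chordCell a) (λ b → b))) ⟩
    sum (λ a → sum (λ b → sumMap f (chordCell a b))) ∎
    where open ≡-Reasoning

  sumMap-chordList-≡0 : ∀ f → (∀ e → plain e ≡ true → f e ≡ 0) → sumMap f chordList ≡ 0
  sumMap-chordList-≡0 f plain⇒0 = trans (sumMap-chordList f) (sum-≡0 _ λ a → sum-≡0 _ λ b → cell a b)
    where
    cell : ∀ a b → sumMap f (chordCell a b) ≡ 0
    cell a b with does (a <? b) in a<b | isChord a b
    ... | true  | true  = trans (+-identityʳ _) (plain⇒0 _
                            (cong not (dec-false (a ≟ b) λ { refl → <-irrefl refl (does⇒ (a <? b) a<b) })))
    ... | true  | false = refl
    ... | false | _     = refl

  chordCell-joins : ∀ u v a b → sumMap (ind ∘ joins u v) (chordCell a b)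
    ≡ ind (listedChord a b ∧ ((a == u ∧ b == v) ∨ (a == v ∧ b == u)))
  chordCell-joins u v a b with does (a <? b) in a<b | isChord a b
  ... | true  | true  rewrite dec-false (a ≟ b) (λ { refl → <-irrefl refl (does⇒ (a <? b) a<b) }) = +-identityʳ _
  ... | true  | false = refl
  ... | false | _     = refl

  listedPairs : V → V → ℕ
  listedPairs u v = sum (λ a → sum (λ b → ind (listedChord a b ∧ ((a == u ∧ b == v) ∨ (a == v ∧ b == u)))))

  listedPairs-self : ∀ u → listedPairs u u ≡ ind (isChord u u)
  listedPairs-self u = begin
    sum (λ a → sum (λ b → ind (listedChord a b ∧ ((a == u ∧ b == u) ∨ (a == u ∧ b == u)))))
      ≡⟨ sum-cong-≗ (λ a → sum-cong-≗ λ b → cong (λ x → ind (listedChord a b ∧ x)) (∨-idem (a == u ∧ b == u))) ⟩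
    sum (λ a → sum (λ b → ind (listedChord a b ∧ (a == u ∧ b == u))))
      ≡⟨ sum₂-at listedChord u u ⟩
    ind (does (u <? u) ∧ isChord u u)
      ≡⟨ cong (λ x → ind (x ∧ isChord u u)) (dec-false (u <? u) (<-irrefl refl)) ⟩
    ind false
      ≡⟨ cong ind (isChord-irrefl u) ⟨
    ind (isChord u u) ∎
    where open ≡-Reasoning

  listedPairs-distinct : ∀ u v → ¬ u ≡ v → listedPairs u v ≡ ind (isChord u v)
  listedPairs-distinct u v u≢v = begin
    sum (λ a → sum (λ b → ind (listedChord a b ∧ ((a == u ∧ b == v) ∨ (a == v ∧ b == u)))))
      ≡⟨ sum-cong-≗ (λ a → sum-cong-≗ λ b → trans (cong ind (∧-distribˡ-∨ (listedChord a b) _ _))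
                                                    (ind-∨-disjoint (listedChord a b ∧ (a == u ∧ b == v)) _ (disjoint a b))) ⟩
    sum (λ a → sum (λ b → uv a b + vu a b))
      ≡⟨ sum-cong-≗ (λ a → ∑-distrib-+ (uv a) (vu a)) ⟩
    sum (λ a → sum (uv a) + sum (vu a))
      ≡⟨ ∑-distrib-+ (sum ∘ uv) (sum ∘ vu) ⟩
    sum (sum ∘ uv) + sum (sum ∘ vu)
      ≡⟨ cong₂ _+_ (sum₂-at listedChord u v) (sum₂-at listedChord v u) ⟩
    ind (listedChord u v) + ind (does (v <? u) ∧ isChord v u)
      ≡⟨ cong (λ x → ind (listedChord u v) + ind (does (v <? u) ∧ x)) (isChord-sym v u) ⟩
    ind (listedChord u v) + ind (does (v <? u) ∧ isChord u v)
      ≡⟨ ind-<-split u v (isChord u v) u≢v ⟩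
    ind (isChord u v) ∎
    where
    open ≡-Reasoning
    uv vu : V → V → ℕ
    uv a b = ind (listedChord a b ∧ (a == u ∧ b == v))
    vu a b = ind (listedChord a b ∧ (a == v ∧ b == u))
    disjoint : ∀ a b → (listedChord a b ∧ (a == u ∧ b == v)) ≡ true → (listedChord a b ∧ (a == v ∧ b == u)) ≡ false
    disjoint a b listed with a ≟ u
    ... | yes refl rewrite dec-false (a ≟ v) u≢v = ∧-zeroʳ (listedChord a b)
    ... | no _     = contradiction (trans (sym (∧-zeroʳ (listedChord a b))) listed) λ ()

  chordList-joins : ∀ u v → sumMap (ind ∘ joins u v) chordList ≡ ind (isChord u v)
  chordList-joins u v = trans (trans (sumMap-chordList _) (sum-cong-≗ (λ a → sum-cong-≗ (chordCell-joins u v a))))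
                              (by-cases (u ≟ v))
    where
    by-cases : Dec (u ≡ v) → listedPairs u v ≡ ind (isChord u v)
    by-cases (yes refl) = listedPairs-self u
    by-cases (no u≢v)   = listedPairs-distinct u v u≢v

  colourOf : List (Coloured (5 + m)) → V → V → Bool
  colourOf []             u v = false
  colourOf ((e , x) ∷ cs) u v = if joins u v e then x else colourOf cs u v

  colourOf-sym : ∀ cs u v → colourOf cs u v ≡ colourOf cs v u
  colourOf-sym []             u v = refl
  colourOf-sym ((e , x) ∷ cs) u v rewrite joins-sym u v e =
    cong (λ y → if joins v u e then x else y) (colourOf-sym cs u v)

  multiplicity : V → V → List (Coloured (5 + m)) → ℕ
  multiplicity u v = sumMap (ind ∘ joins u v ∘ proj₁)

  colourOf-unique : ∀ cs u v b c → multiplicity u v cs ≡ ind b →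
    ind (b ∧ (colourOf cs u v ==ᵇ c)) ≡ sumMap (λ ce → ind (joins u v (proj₁ ce) ∧ (proj₂ ce ==ᵇ c))) cs
  colourOf-unique []             u v false c mult = refl
  colourOf-unique ((e , x) ∷ cs) u v b     c mult with joins u v e
  ... | false = colourOf-unique cs u v b c mult
  ... | true with b
  ...   | true  = sym (trans (cong (ind (x ==ᵇ c) +_) rest≡0) (+-identityʳ _))
    where
    rest≡0 : sumMap (λ ce → ind (joins u v (proj₁ ce) ∧ (proj₂ ce ==ᵇ c))) cs ≡ 0
    rest≡0 = n≤0⇒n≡0 (≤-trans (sumMap-mono-≤ cs (λ ce → ind-∧≤ˡ (joins u v (proj₁ ce)) _))
                              (≤-reflexive (ℕ.suc-injective mult)))
  ...   | false = contradiction mult λ ()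

  plain⇒untwisted : ∀ e → plain e ≡ true → twisted e ≡ false
  plain⇒untwisted e pl = not-true (proj₁ (∧-true (proj₂ (∧-true {not (virtual e)} pl))))

  plain⇒proper : ∀ e → plain e ≡ true → ¬ src e ≡ dst e
  plain⇒proper e pl s≡d = contradiction (trans (sym (dec-true (src e ≟ dst e) s≡d))
    (not-true (proj₂ (∧-true (proj₂ (∧-true {not (virtual e)} pl)))))) λ ()

  sum-joins : ∀ u c (ce : Coloured (5 + m)) →
    sum (λ v → ind (joins u v (proj₁ ce) ∧ (proj₂ ce ==ᵇ c))) ≡ (if plain (proj₁ ce) then colouredEnds u c ce else 0)
  sum-joins u c (e , x) with plain e in pl
  ... | false = sum-≡0 {n = 5 + m} _ λ v → refl
  ... | true  = begin
    sum (λ v → ind (((src e == u ∧ dst e == v) ∨ (src e == v ∧ dst e == u)) ∧ y))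
      ≡⟨ sum-cong-≗ (λ v → trans (cong ind (∧-distribʳ-∨ y (src e == u ∧ dst e == v) _))
                                 (ind-∨-disjoint ((src e == u ∧ dst e == v) ∧ y) _ (disjoint v))) ⟩
    sum (λ v → ind ((src e == u ∧ dst e == v) ∧ y) + ind ((src e == v ∧ dst e == u) ∧ y))
      ≡⟨ ∑-distrib-+ (λ v → ind ((src e == u ∧ dst e == v) ∧ y)) (λ v → ind ((src e == v ∧ dst e == u) ∧ y)) ⟩
    sum (λ v → ind ((src e == u ∧ dst e == v) ∧ y)) + sum (λ v → ind ((src e == v ∧ dst e == u) ∧ y))
      ≡⟨ cong₂ _+_ (trans (sum-cong-≗ (λ v → cong ind (∧-swapʳ (src e == u) (dst e == v) y)))
                          (sum-ind-∧-== (λ _ → src e == u ∧ y) (dst e)))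
                   (trans (sum-cong-≗ (λ v → cong ind (∧-rotate (src e == v) (dst e == u) y)))
                          (sum-ind-∧-== (λ _ → dst e == u ∧ y) (src e))) ⟩
    ind (src e == u ∧ y) + ind (dst e == u ∧ y)
      ≡⟨ cong (λ z → ind (src e == u ∧ y) + ind (dst e == u ∧ (z ==ᵇ c))) (xor-identityʳ x) ⟨
    ind (src e == u ∧ y) + ind (dst e == u ∧ ((x xor false) ==ᵇ c))
      ≡⟨ cong (λ t → ind (src e == u ∧ y) + ind (dst e == u ∧ ((x xor t) ==ᵇ c))) (plain⇒untwisted e pl) ⟨
    colouredEnds u c (e , x) ∎
    where
    open ≡-Reasoning
    y = x ==ᵇ c
    ∧-swapʳ : ∀ a b c → (a ∧ b) ∧ c ≡ (a ∧ c) ∧ b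
    ∧-swapʳ true  b c = ∧-comm b c
    ∧-swapʳ false b c = refl
    ∧-rotate : ∀ a b c → (a ∧ b) ∧ c ≡ (b ∧ c) ∧ a
    ∧-rotate true  b c = sym (∧-identityʳ (b ∧ c))
    ∧-rotate false b c = sym (∧-zeroʳ (b ∧ c))
    dst≡ : ∀ v → ((src e == u ∧ dst e == v) ∧ y) ≡ true → dst e ≡ v
    dst≡ v h = does⇒ (dst e ≟ v) (proj₂ (∧-true {src e == u} (proj₁ (∧-true {src e == u ∧ dst e == v} h))))
    disjoint : ∀ v → ((src e == u ∧ dst e == v) ∧ y) ≡ true → ((src e == v ∧ dst e == u) ∧ y) ≡ false
    disjoint v h rewrite dec-false (src e ≟ v) (λ s≡v → plain⇒proper e pl (trans s≡v (sym (dst≡ v h)))) = refl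

  chordColourDeg : List (Coloured (5 + m)) → V → Bool → ℕ
  chordColourDeg cs u c = count (λ v → isChord u v ∧ (colourOf cs u v ==ᵇ c))

  plainColourDeg : List (Coloured (5 + m)) → V → Bool → ℕ
  plainColourDeg cs u c = sumMap (λ ce → if plain (proj₁ ce) then colouredEnds u c ce else 0) cs

  chordColourDeg≡plainColourDeg : ∀ cs u c → (∀ v → multiplicity u v cs ≡ ind (isChord u v)) →
    chordColourDeg cs u c ≡ plainColourDeg cs u c
  chordColourDeg≡plainColourDeg cs u c mult = begin
    count (λ v → isChord u v ∧ (colourOf cs u v ==ᵇ c))
      ≡⟨ count≡sum (λ v → isChord u v ∧ (colourOf cs u v ==ᵇ c)) ⟩
    sum (λ v → ind (isChord u v ∧ (colourOf cs u v ==ᵇ c)))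
      ≡⟨ sum-cong-≗ (λ v → colourOf-unique cs u v (isChord u v) c (mult v)) ⟩
    sum (λ v → sumMap (λ ce → ind (joins u v (proj₁ ce) ∧ (proj₂ ce ==ᵇ c))) cs)
      ≡⟨ sum-sumMap-comm (λ v ce → ind (joins u v (proj₁ ce) ∧ (proj₂ ce ==ᵇ c))) cs ⟩
    sumMap (λ ce → sum (λ v → ind (joins u v (proj₁ ce) ∧ (proj₂ ce ==ᵇ c)))) cs
      ≡⟨ sumMap-cong cs (sum-joins u c) ⟩
    plainColourDeg cs u c ∎
    where open ≡-Reasoning

  virtualColourDeg : List (Coloured (5 + m)) → V → Bool → ℕ
  virtualColourDeg cs u c = sumMap (λ ce → if virtual (proj₁ ce) then colouredEnds u c ce else 0) cs

  virtualDeg : V → List (Edge (5 + m)) → ℕ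
  virtualDeg u = sumMap (λ e → if virtual e then ends u e else 0)

  AllVirtual : List (Edge (5 + m)) → Set
  AllVirtual Vl = sumMap (ind ∘ not ∘ virtual) Vl ≡ 0

  strayFrom : V → V → Edge (5 + m) → Bool
  strayFrom s s′ e = virtual e ∧ not (src e == s ∧ dst e == s′)

  twistedVirtual : Edge (5 + m) → Bool
  twistedVirtual e = virtual e ∧ twisted e

  module ColouredChords (Vl : List (Edge (5 + m))) (allVirtual : AllVirtual Vl)
                        (cs : List (Coloured (5 + m))) (isCol : ColouringOf cs (chordList ++ Vl)) where

    sumMap-edges : ∀ f → sumMap (f ∘ proj₁) cs ≡ sumMap f chordList + sumMap f Vl
    sumMap-edges f = trans (sym (sumMap-map f proj₁ cs)) (trans (sumMap-↭ f isCol) (sumMap-++ f chordList Vl))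

    sumMap-Vl-≡0 : ∀ f → (∀ e → f e ≤ ind (not (virtual e))) → sumMap f Vl ≡ 0
    sumMap-Vl-≡0 f f≤ = n≤0⇒n≡0 (≤-trans (sumMap-mono-≤ Vl f≤) (≤-reflexive allVirtual))

    multiplicity≡ : ∀ u v → multiplicity u v cs ≡ ind (isChord u v)
    multiplicity≡ u v = begin
      multiplicity u v cs
        ≡⟨ sumMap-edges (ind ∘ joins u v) ⟩
      sumMap (ind ∘ joins u v) chordList + sumMap (ind ∘ joins u v) Vl
        ≡⟨ cong₂ _+_ (chordList-joins u v)
                     (sumMap-Vl-≡0 _ (λ e → ≤-trans (ind-∧≤ˡ (plain e) _) (ind-∧≤ˡ (not (virtual e)) _))) ⟩
      ind (isChord u v) + 0
        ≡⟨ +-identityʳ _ ⟩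
      ind (isChord u v) ∎
      where open ≡-Reasoning

    defective : Edge (5 + m) → Bool
    defective e = not (virtual e) ∧ not (plain e)

    no-defective : sumMap (ind ∘ defective ∘ proj₁) cs ≡ 0
    no-defective = trans (sumMap-edges (ind ∘ defective))
      (cong₂ _+_ (sumMap-chordList-≡0 _ λ e pl →
                    trans (cong (λ b → ind (not (virtual e) ∧ not b)) pl) (cong ind (∧-zeroʳ (not (virtual e)))))
                 (sumMap-Vl-≡0 _ (λ e → ind-∧≤ˡ (not (virtual e)) _)))

    defectiveColourDeg≡0 : ∀ u c → sumMap (λ ce → if defective (proj₁ ce) then colouredEnds u c ce else 0) cs ≡ 0
    defectiveColourDeg≡0 u c = n≤0⇒n≡0 (begin
      sumMap (λ ce → if defective (proj₁ ce) then colouredEnds u c ce else 0) cs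
        ≤⟨ sumMap-mono-≤ cs (λ ce → if≤2*ind (defective (proj₁ ce))
                                               (≤-trans (colouredEnds≤ends u c ce) (ends≤2 u (proj₁ ce)))) ⟩
      sumMap (λ ce → 2 * ind (defective (proj₁ ce))) cs
        ≡⟨ sumMap-distribˡ-* 2 (ind ∘ defective ∘ proj₁) cs ⟩
      2 * sumMap (ind ∘ defective ∘ proj₁) cs
        ≡⟨ cong (2 *_) no-defective ⟩
      0 ∎)
      where
      open ≤-Reasoning
      if≤2*ind : ∀ {y} b → y ≤ 2 → (if b then y else 0) ≤ 2 * ind b
      if≤2*ind true  y≤2 = y≤2
      if≤2*ind false y≤2 = z≤n

    colourDeg≡chord+virtual : ∀ u c → colourDeg u c cs ≡ chordColourDeg cs u c + virtualColourDeg cs u c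
    colourDeg≡chord+virtual u c = begin
      colourDeg u c cs
        ≡⟨ sumMap-cong cs (λ (e , x) → by-kind (virtual e) (not (twisted e) ∧ not (src e == dst e)) _) ⟩
      sumMap (λ ce → P ce + W ce + D ce) cs
        ≡⟨ sumMap-distrib-+ (λ ce → P ce + W ce) D cs ⟩
      sumMap (λ ce → P ce + W ce) cs + sumMap D cs
        ≡⟨ cong₂ _+_ (sumMap-distrib-+ P W cs) (defectiveColourDeg≡0 u c) ⟩
      plainColourDeg cs u c + virtualColourDeg cs u c + 0
        ≡⟨ +-identityʳ _ ⟩
      plainColourDeg cs u c + virtualColourDeg cs u c
        ≡⟨ cong (_+ virtualColourDeg cs u c) (chordColourDeg≡plainColourDeg cs u c (multiplicity≡ u)) ⟨
      chordColourDeg cs u c + virtualColourDeg cs u c ∎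
      where
      open ≡-Reasoning
      P W D : Coloured (5 + m) → ℕ
      P ce = if plain (proj₁ ce) then colouredEnds u c ce else 0
      W ce = if virtual (proj₁ ce) then colouredEnds u c ce else 0
      D ce = if defective (proj₁ ce) then colouredEnds u c ce else 0
      by-kind : ∀ v r y → y ≡ (if not v ∧ r then y else 0) + (if v then y else 0) + (if not v ∧ not (not v ∧ r) then y else 0)
      by-kind true  r     y = sym (+-identityʳ y)
      by-kind false true  y = trans (sym (+-identityʳ y)) (sym (+-identityʳ (y + 0)))
      by-kind false false y = refl

    chordColourDeg-split : ∀ u → chordColourDeg cs u true + chordColourDeg cs u false ≡ chordDeg u
    chordColourDeg-split u = begin
      chordColourDeg cs u true + chordColourDeg cs u false
        ≡⟨ cong₂ _+_ (count≡sum (λ v → isChord u v ∧ (colourOf cs u v ==ᵇ true)))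
                     (count≡sum (λ v → isChord u v ∧ (colourOf cs u v ==ᵇ false))) ⟩
      sum (λ v → ind (isChord u v ∧ (colourOf cs u v ==ᵇ true)))
        + sum (λ v → ind (isChord u v ∧ (colourOf cs u v ==ᵇ false)))
        ≡⟨ ∑-distrib-+ (λ v → ind (isChord u v ∧ (colourOf cs u v ==ᵇ true)))
                       (λ v → ind (isChord u v ∧ (colourOf cs u v ==ᵇ false))) ⟨
      sum (λ v → ind (isChord u v ∧ (colourOf cs u v ==ᵇ true)) + ind (isChord u v ∧ (colourOf cs u v ==ᵇ false)))
        ≡⟨ sum-cong-≗ (λ v → ind-∧-==ᵇ-split (isChord u v) (colourOf cs u v)) ⟩
      sum (ind ∘ isChord u)
        ≡⟨ count≡sum (isChord u) ⟨
      chordDeg u ∎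
      where open ≡-Reasoning

    virtualColourDeg-split : ∀ u → virtualColourDeg cs u true + virtualColourDeg cs u false ≡ virtualDeg u Vl
    virtualColourDeg-split u = begin
      virtualColourDeg cs u true + virtualColourDeg cs u false
        ≡⟨ sumMap-distrib-+ (λ ce → if virtual (proj₁ ce) then colouredEnds u true ce else 0) _ cs ⟨
      sumMap (λ ce → (if virtual (proj₁ ce) then colouredEnds u true ce else 0)
                   + (if virtual (proj₁ ce) then colouredEnds u false ce else 0)) cs
        ≡⟨ sumMap-cong cs (λ ce → if-virtual (virtual (proj₁ ce)) (colouredEnds-split u ce)) ⟩
      sumMap (λ ce → if virtual (proj₁ ce) then ends u (proj₁ ce) else 0) cs
        ≡⟨ sumMap-edges (λ e → if virtual e then ends u e else 0) ⟩
      virtualDeg u chordList + virtualDeg u Vl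
        ≡⟨ cong (_+ virtualDeg u Vl) (sumMap-chordList-≡0 _ λ e pl → cong (λ b → if b then ends u e else 0)
                                                                      (not-true (proj₁ (∧-true {not (virtual e)} pl)))) ⟩
      virtualDeg u Vl ∎
      where
      open ≡-Reasoning
      if-virtual : ∀ b {x y z} → x + y ≡ z → (if b then x else 0) + (if b then y else 0) ≡ (if b then z else 0)
      if-virtual true  eq = eq
      if-virtual false eq = refl

    deg≡chordDeg+virtualDeg : ∀ u → deg u (chordList ++ Vl) ≡ chordDeg u + virtualDeg u Vl
    deg≡chordDeg+virtualDeg u = begin
      deg u (chordList ++ Vl)
        ≡⟨ colourDeg-split u cs isCol ⟨
      colourDeg u true cs + colourDeg u false cs
        ≡⟨ cong₂ _+_ (colourDeg≡chord+virtual u true) (colourDeg≡chord+virtual u false) ⟩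
      (chordColourDeg cs u true + virtualColourDeg cs u true) + (chordColourDeg cs u false + virtualColourDeg cs u false)
        ≡⟨ interchange (chordColourDeg cs u true) _ _ _ ⟩
      (chordColourDeg cs u true + chordColourDeg cs u false) + (virtualColourDeg cs u true + virtualColourDeg cs u false)
        ≡⟨ cong₂ _+_ (chordColourDeg-split u) (virtualColourDeg-split u) ⟩
      chordDeg u + virtualDeg u Vl ∎
      where open ≡-Reasoning

    chordColourDeg-bound : ∀ u c b → 2 * colourDeg u c cs ≤ deg u (chordList ++ Vl) + b →
      2 * chordColourDeg cs u c ≤ chordDeg u + virtualDeg u Vl + b
    chordColourDeg-bound u c b bound = begin
      2 * chordColourDeg cs u c                          ≤⟨ *-monoʳ-≤ 2 (m≤m+n (chordColourDeg cs u c) (virtualColourDeg cs u c)) ⟩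
      2 * (chordColourDeg cs u c + virtualColourDeg cs u c) ≡⟨ cong (2 *_) (colourDeg≡chord+virtual u c) ⟨
      2 * colourDeg u c cs                               ≤⟨ bound ⟩
      deg u (chordList ++ Vl) + b                        ≡⟨ cong (_+ b) (deg≡chordDeg+virtualDeg u) ⟩
      chordDeg u + virtualDeg u Vl + b                   ∎
      where open ≤-Reasoning

    -- A virtual edge from s to s′ has an even number of ends of colour true at s and s′, plus one
    -- if it is twisted.
    module Parity (s s′ : V) (s≢s′ : ¬ s ≡ s′) where

      stray : Edge (5 + m) → Bool
      stray = strayFrom s s′

      virtualEnds : Coloured (5 + m) → ℕ
      virtualEnds ce = if virtual (proj₁ ce) then colouredEnds s true ce + colouredEnds s′ true ce else 0

      virtualEnds-parity : ∀ ce → stray (proj₁ ce) ≡ false →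
        ∃ λ k → virtualEnds ce ≡ 2 * k + ind (twistedVirtual (proj₁ ce))
      virtualEnds-parity (e , x) not-stray with virtual e
      ... | false = 0 , refl
      ... | true
        rewrite does⇒ (src e ≟ s) (proj₁ (∧-true {src e == s} (not-false not-stray)))
              | does⇒ (dst e ≟ s′) (proj₂ (∧-true {src e == s} (not-false not-stray)))
              | ==-refl s | ==-refl s′ | dec-false (s′ ≟ s) (s≢s′ ∘ sym) | dec-false (s ≟ s′) s≢s′
        = both-ends x (twisted e)
        where
        both-ends : ∀ x t → ∃ λ k → ind (x ==ᵇ true) + 0 + (0 + ind ((x xor t) ==ᵇ true)) ≡ 2 * k + ind t
        both-ends true  true  = 0 , refl
        both-ends true  false = 1 , refl
        both-ends false true  = 0 , refl
        both-ends false false = 0 , refl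

      sumMap-virtualEnds-parity : ∀ L → sumMap (ind ∘ stray ∘ proj₁) L ≡ 0 →
        ∃ λ K → sumMap virtualEnds L ≡ 2 * K + sumMap (ind ∘ twistedVirtual ∘ proj₁) L
      sumMap-virtualEnds-parity []       none = 0 , refl
      sumMap-virtualEnds-parity (ce ∷ L) none =
        let (k , eq) = virtualEnds-parity ce (ind≡0 (m+n≡0⇒m≡0 (ind (stray (proj₁ ce))) none))
            (K , eqs) = sumMap-virtualEnds-parity L (m+n≡0⇒n≡0 (ind (stray (proj₁ ce))) none)
        in k + K , trans (cong₂ _+_ eq eqs) (regroup k (ind (twistedVirtual (proj₁ ce))) K _)
        where
        ind≡0 : ∀ {b} → ind b ≡ 0 → b ≡ false
        ind≡0 {false} _ = refl
        regroup : ∀ a b c d → 2 * a + b + (2 * c + d) ≡ 2 * (a + c) + (b + d)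
        regroup = solve-∀

      virtualColourDeg-odd : sumMap (ind ∘ stray) Vl ≡ 0 → sumMap (ind ∘ twistedVirtual) Vl ≡ 1 →
        ∃ λ K → virtualColourDeg cs s true + virtualColourDeg cs s′ true ≡ 2 * K + 1
      virtualColourDeg-odd no-stray one-twisted =
        let (K , eq) = sumMap-virtualEnds-parity cs
                         (trans (sumMap-edges (ind ∘ stray)) (cong₂ _+_ (sumMap-chordList-≡0 _ (λ e → plain⇒¬virtual e)) no-stray))
        in K , (begin
          virtualColourDeg cs s true + virtualColourDeg cs s′ true
            ≡⟨ sumMap-distrib-+ (λ ce → if virtual (proj₁ ce) then colouredEnds s true ce else 0) _ cs ⟨
          sumMap (λ ce → (if virtual (proj₁ ce) then colouredEnds s true ce else 0)
                       + (if virtual (proj₁ ce) then colouredEnds s′ true ce else 0)) cs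
            ≡⟨ sumMap-cong cs (λ ce → if-+ (virtual (proj₁ ce))) ⟩
          sumMap virtualEnds cs
            ≡⟨ eq ⟩
          2 * K + sumMap (ind ∘ twistedVirtual ∘ proj₁) cs
            ≡⟨ cong (2 * K +_) (trans (sumMap-edges (ind ∘ twistedVirtual))
                                      (cong₂ _+_ (sumMap-chordList-≡0 _ (λ e → plain⇒¬virtual e)) one-twisted)) ⟩
          2 * K + 1 ∎)
        where
        open ≡-Reasoning
        plain⇒¬virtual : ∀ e {b} → plain e ≡ true → ind (virtual e ∧ b) ≡ 0
        plain⇒¬virtual e pl rewrite not-true (proj₁ (∧-true {not (virtual e)} pl)) = refl
        if-+ : ∀ b {x y} → (if b then x else 0) + (if b then y else 0) ≡ (if b then x + y else 0)
        if-+ true  = refl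
        if-+ false = refl

      asymmetry : sumMap (ind ∘ stray) Vl ≡ 0 → sumMap (ind ∘ twistedVirtual) Vl ≡ 1 →
        2 * colourDeg s true cs ≡ deg s (chordList ++ Vl) → 2 * colourDeg s′ true cs ≡ deg s′ (chordList ++ Vl) →
        deg s (chordList ++ Vl) ≡ deg s′ (chordList ++ Vl) →
        ¬ chordColourDeg cs s true ≡ chordColourDeg cs s′ true
      asymmetry no-stray one-twisted balanced balanced′ same-deg same-chords =
        even≢odd (virtualColourDeg cs s true) K (begin
          2 * virtualColourDeg cs s true
            ≡⟨ solve-double (virtualColourDeg cs s true) ⟩
          virtualColourDeg cs s true + virtualColourDeg cs s true
            ≡⟨ cong (virtualColourDeg cs s true +_) same-virtual ⟩
          virtualColourDeg cs s true + virtualColourDeg cs s′ true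
            ≡⟨ odd ⟩
          2 * K + 1
            ≡⟨ +-comm (2 * K) 1 ⟩
          suc (2 * K) ∎)
        where
        open ≡-Reasoning
        K = proj₁ (virtualColourDeg-odd no-stray one-twisted)
        odd = proj₂ (virtualColourDeg-odd no-stray one-twisted)
        solve-double : ∀ a → 2 * a ≡ a + a
        solve-double = solve-∀
        same-virtual : virtualColourDeg cs s true ≡ virtualColourDeg cs s′ true
        same-virtual = +-cancelˡ-≡ (chordColourDeg cs s true) _ _ (*-cancelˡ-≡ _ _ 2 (begin
          2 * (chordColourDeg cs s true + virtualColourDeg cs s true)
            ≡⟨ cong (2 *_) (colourDeg≡chord+virtual s true) ⟨
          2 * colourDeg s true cs
            ≡⟨ trans balanced (trans same-deg (sym balanced′)) ⟩
          2 * colourDeg s′ true cs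
            ≡⟨ cong (2 *_) (colourDeg≡chord+virtual s′ true) ⟩
          2 * (chordColourDeg cs s′ true + virtualColourDeg cs s′ true)
            ≡⟨ cong (λ r → 2 * (r + virtualColourDeg cs s′ true)) same-chords ⟨
          2 * (chordColourDeg cs s true + virtualColourDeg cs s′ true) ∎))

  count-∈ᵇ≤length : ∀ (done : List V) → count (_∈ᵇ done) ≤ length done
  count-∈ᵇ≤length []         = ≤-reflexive (count-false {5 + m})
  count-∈ᵇ≤length (t ∷ done) = ≤-trans (count-∨≤ (_== t) (_∈ᵇ done))
    (+-mono-≤ (count-≤1 (_== t) λ v w v≡t w≡t → trans (does⇒ (v ≟ t) v≡t) (sym (does⇒ (w ≟ t) w≡t)))
              (count-∈ᵇ≤length done))

  chordNeighbourOutside : ∀ t (done : List V) → length done < chordDeg t →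
    ∃ λ z → isChord t z ≡ true × z ∉ done
  chordNeighbourOutside t done few =
    let (z , chord∧∉) = count-witness outside (+-cancelʳ-≤ (count (_∈ᵇ done)) 1 _ (≤-trans
                          (+-monoʳ-≤ 1 (count-∈ᵇ≤length done)) (≤-trans few split)))
    in z , proj₁ (∧-true chord∧∉) ,
       λ z∈ → contradiction (trans (sym (dec-true (Any.any? (z ≟_) done) z∈)) (not-true (proj₂ (∧-true chord∧∉)))) λ ()
    where
    outside : V → Bool
    outside z = isChord t z ∧ not (z ∈ᵇ done)
    split : chordDeg t ≤ count outside + count (_∈ᵇ done)
    split = begin
      count (isChord t)                                   ≡⟨ count≡sum (isChord t) ⟩
      sum (ind ∘ isChord t)                               ≤⟨ sum-mono-≤ (λ z → ind≤ (isChord t z) (z ∈ᵇ done)) ⟩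
      sum (λ z → ind (outside z) + ind (z ∈ᵇ done))       ≡⟨ ∑-distrib-+ (ind ∘ outside) (λ z → ind (z ∈ᵇ done)) ⟩
      sum (ind ∘ outside) + sum (λ z → ind (z ∈ᵇ done))   ≡⟨ cong₂ _+_ (count≡sum outside) (count≡sum (_∈ᵇ done)) ⟨
      count outside + count (_∈ᵇ done)                    ∎
      where
      open ≤-Reasoning
      ind≤ : ∀ a b → ind a ≤ ind (a ∧ not b) + ind b
      ind≤ true  true  = s≤s z≤n
      ind≤ true  false = s≤s z≤n
      ind≤ false b     = z≤n

  joins⇒ends : ∀ u v e → joins u v e ≡ true → (src e ≡ u × dst e ≡ v) ⊎ (src e ≡ v × dst e ≡ u)
  joins⇒ends u v e j with ∨-true (proj₂ (∧-true {plain e} j))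
  ... | inj₁ uv = inj₁ (does⇒ (src e ≟ u) (proj₁ (∧-true uv)) , does⇒ (dst e ≟ v) (proj₂ (∧-true uv)))
  ... | inj₂ vu = inj₂ (does⇒ (src e ≟ v) (proj₁ (∧-true vu)) , does⇒ (dst e ≟ u) (proj₂ (∧-true vu)))

  joins≤outEnd : ∀ {t z done} e → ¬ t ≡ z → z ∉ done → ind (joins t z e) ≤ ind (outEnd done t e)
  joins≤outEnd {t} {z} {done} e t≢z z∉ with joins t z e in j
  ... | false = z≤n
  ... | true with joins⇒ends t z e j
  ...   | inj₁ (refl , refl) rewrite ==-refl (src e) | dec-false (dst e ≟ src e) (t≢z ∘ sym)
                                   | dec-false (Any.any? (dst e ≟_) done) z∉ = ≤-refl
  ...   | inj₂ (refl , refl) rewrite ==-refl (dst e) | dec-false (src e ≟ dst e) (t≢z ∘ sym)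
                                   | dec-false (Any.any? (src e ≟_) done) z∉ = ≤-refl

  1≤outDeg : ∀ Vl {t z done} → isChord t z ≡ true → z ∉ done → 1 ≤ outDeg done t (chordList ++ Vl)
  1≤outDeg Vl {t} {z} {done} chord z∉ = begin
    1                                                    ≡⟨ cong ind chord ⟨
    ind (isChord t z)                                    ≡⟨ chordList-joins t z ⟨
    sumMap (ind ∘ joins t z) chordList                   ≤⟨ sumMap-mono-≤ chordList (λ e → joins≤outEnd e t≢z z∉) ⟩
    outDeg done t chordList                              ≤⟨ m≤m+n _ _ ⟩
    outDeg done t chordList + outDeg done t Vl           ≡⟨ sumMap-++ (ind ∘ outEnd done t) chordList Vl ⟨
    outDeg done t (chordList ++ Vl)                      ∎
    where
    open ≤-Reasoning
    t≢z : ¬ t ≡ z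
    t≢z refl = contradiction (trans (sym chord) (isChord-irrefl t)) λ ()

  Schedulable : List V → List V → Set
  Schedulable done []       = ⊤
  Schedulable done (t ∷ ts) = t ∉ done × length done < chordDeg t × Schedulable (t ∷ done) ts

  schedule : ∀ Vl done ts → Schedulable done ts → Schedule done ts (chordList ++ Vl)
  schedule Vl done []       tt                  = tt
  schedule Vl done (t ∷ ts) (t∉ , few , sched) =
    let (z , chord , z∉) = chordNeighbourOutside t done few
    in t∉ , 1≤outDeg Vl chord z∉ , schedule Vl (t ∷ done) ts sched

  parallel : V → V → List Bool → List (Edge (5 + m))
  parallel a b = map (λ t → edge a b t true)

  parallel-allVirtual : ∀ a b ts → AllVirtual (parallel a b ts)
  parallel-allVirtual a b []       = refl
  parallel-allVirtual a b (t ∷ ts) = parallel-allVirtual a b ts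

  parallel-no-stray : ∀ a b ts → sumMap (ind ∘ strayFrom a b) (parallel a b ts) ≡ 0
  parallel-no-stray a b []       = refl
  parallel-no-stray a b (t ∷ ts) rewrite ==-refl a | ==-refl b = parallel-no-stray a b ts

  virtualDeg-parallel : ∀ u a b ts → virtualDeg u (parallel a b ts) ≡ length ts * (ind (a == u) + ind (b == u))
  virtualDeg-parallel u a b []       = refl
  virtualDeg-parallel u a b (t ∷ ts) = cong (ind (a == u) + ind (b == u) +_) (virtualDeg-parallel u a b ts)

  virtualDeg-parallel-away : ∀ {u a b} ts → ¬ u ≡ a → ¬ u ≡ b → virtualDeg u (parallel a b ts) ≡ 0
  virtualDeg-parallel-away {u} {a} {b} ts u≢a u≢b
    rewrite virtualDeg-parallel u a b ts | dec-false (a ≟ u) (u≢a ∘ sym) | dec-false (b ≟ u) (u≢b ∘ sym) = *-zeroʳ (length ts)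

  virtualDeg-parallel-src : ∀ {a b} ts → ¬ b ≡ a → virtualDeg a (parallel a b ts) ≡ length ts
  virtualDeg-parallel-src {a} {b} ts b≢a
    rewrite virtualDeg-parallel a a b ts | ==-refl a | dec-false (b ≟ a) b≢a = *-identityʳ (length ts)

  virtualDeg-parallel-dst : ∀ {a b} ts → ¬ b ≡ a → virtualDeg b (parallel a b ts) ≡ length ts
  virtualDeg-parallel-dst {a} {b} ts b≢a
    rewrite virtualDeg-parallel b a b ts | ==-refl b | dec-false (a ≟ b) (b≢a ∘ sym) = *-identityʳ (length ts)

-- Balanced, asymmetric chord colourings

module ChordColourings {m : ℕ} (G : Graph (5 + m)) (path : Traceable G) where
  open HamiltonianPath G path

  record GoodColouring : Set where
    field
      chords     : List (Coloured (5 + m))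
      majority   : ∀ u c → 2 * chordColourDeg chords u c ≤ pathDeg u + chordDeg u
      asymmetric : (∀ c → chordColourDeg chords s₀ c ≡ chordColourDeg chords s₁ c) →
                   (∀ c → chordColourDeg chords q₀ c ≡ chordColourDeg chords q₁ c) → ⊥

  majority-from : ∀ cs → (∀ u c → ¬ u ≡ s₀ → ¬ u ≡ s₁ → 2 * chordColourDeg cs u c ≤ chordDeg u + 2) →
    (∀ c → 2 * chordColourDeg cs s₀ c ≤ chordDeg s₀ + 1) → (∀ c → 2 * chordColourDeg cs s₁ c ≤ chordDeg s₁ + 1) →
    ∀ u c → 2 * chordColourDeg cs u c ≤ pathDeg u + chordDeg u
  majority-from cs inner at-s₀ at-s₁ u c with u ≟ s₀ | u ≟ s₁
  ... | yes refl | _        = slack-≤ (at-s₀ c) 1≤pathDeg-s₀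
  ... | no _     | yes refl = slack-≤ (at-s₁ c) 1≤pathDeg-s₁
  ... | no u≢s₀  | no u≢s₁  = slack-≤ (inner u c u≢s₀ u≢s₁) (2≤pathDeg u u≢s₀ u≢s₁)

  module FromBalanced (Vl : List (Edge (5 + m))) (allVirtual : AllVirtual Vl)
                      (ts : List V) (sched : Schedulable [] ts) where

    balanced : BalancedColouring ts (chordList ++ Vl)
    balanced = balancedColouring ts (chordList ++ Vl) (schedule Vl [] ts sched)

    open BalancedColouring balanced public using (colouring)
    open ColouredChords Vl allVirtual colouring (BalancedColouring.isColouring balanced) public

    bound-away : ∀ u c → virtualDeg u Vl ≡ 0 → 2 * chordColourDeg colouring u c ≤ chordDeg u + 2
    bound-away u c vd≡0 = subst (λ d → 2 * chordColourDeg colouring u c ≤ d + 2)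
      (trans (cong (chordDeg u +_) vd≡0) (+-identityʳ _))
      (chordColourDeg-bound u c 2 (BalancedColouring.excess≤2 balanced u c))

    bound-scheduled : ∀ u c → u ∈ ts → virtualDeg u Vl ≡ 0 → 2 * chordColourDeg colouring u c ≤ chordDeg u + 1
    bound-scheduled u c u∈ vd≡0 = subst (λ d → 2 * chordColourDeg colouring u c ≤ d + 1)
      (trans (cong (chordDeg u +_) vd≡0) (+-identityʳ _))
      (chordColourDeg-bound u c 1 (BalancedColouring.excess≤1 balanced u c u∈))

    balanced-at : ∀ u c k → u ∈ ts → chordDeg u + virtualDeg u Vl ≡ 2 * k →
      2 * colourDeg u c colouring ≡ deg u (chordList ++ Vl)
    balanced-at u c k u∈ even =
      BalancedColouring.even⇒balanced balanced u c k u∈ (trans (deg≡chordDeg+virtualDeg u) even)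

    bound-even : ∀ u c k → u ∈ ts → chordDeg u + virtualDeg u Vl ≡ 2 * k →
      2 * chordColourDeg colouring u c ≤ chordDeg u + virtualDeg u Vl
    bound-even u c k u∈ even = subst (2 * chordColourDeg colouring u c ≤_) (+-identityʳ _)
      (chordColourDeg-bound u c 0 (≤-reflexive (trans (balanced-at u c k u∈ even) (sym (+-identityʳ _)))))

    asymmetric-by-parity : ∀ a b k → ¬ a ≡ b → a ∈ ts → b ∈ ts →
      sumMap (ind ∘ strayFrom a b) Vl ≡ 0 → sumMap (ind ∘ twistedVirtual) Vl ≡ 1 →
      chordDeg a + virtualDeg a Vl ≡ 2 * k → chordDeg a + virtualDeg a Vl ≡ chordDeg b + virtualDeg b Vl →
      ¬ chordColourDeg colouring a true ≡ chordColourDeg colouring b true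
    asymmetric-by-parity a b k a≢b a∈ b∈ no-stray one-twisted even same =
      Parity.asymmetry a b a≢b no-stray one-twisted
        (balanced-at a true k a∈ even) (balanced-at b true k b∈ (trans (sym same) even))
        (trans (deg≡chordDeg+virtualDeg a) (trans same (sym (deg≡chordDeg+virtualDeg b))))

    chordDeg-cong : ∀ a b → (∀ c → chordColourDeg colouring a c ≡ chordColourDeg colouring b c) → chordDeg a ≡ chordDeg b
    chordDeg-cong a b same = trans (sym (chordColourDeg-split a))
      (trans (cong₂ _+_ (same true) (same false)) (chordColourDeg-split b))

  module _ (md : MinDegree≥ G 4) where

    schedule-s : Schedulable [] (s₀ ∷ s₁ ∷ [])
    schedule-s = (λ ()) , ≤-trans (s≤s z≤n) (3≤chordDeg-s₀ md) ,
                 (λ { (here eq) → s₁≢s₀ eq }) , ≤-trans (s≤s (s≤s z≤n)) (3≤chordDeg-s₁ md) , tt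

    schedule-q-s : ∀ k → chordDeg s₀ ≡ chordDeg s₁ → chordDeg s₀ ≡ 2 * k → Schedulable [] (q₀ ∷ q₁ ∷ s₀ ∷ s₁ ∷ [])
    schedule-q-s k same-s even-s =
      (λ ()) , ≤-trans (s≤s z≤n) (2≤chordDeg md q₀) ,
      (λ { (here eq) → q₁≢q₀ eq }) , 2≤chordDeg md q₁ ,
      (λ { (here eq) → q₁≢s₀ (sym eq) ; (there (here eq)) → q₀≢s₀ (sym eq) }) , 3≤chordDeg-s₀ md ,
      (λ { (here eq) → s₁≢s₀ eq ; (there (here eq)) → q₁≢s₁ (sym eq)
         ; (there (there (here eq))) → q₀≢s₁ (sym eq) }) ,
      subst (4 ≤_) (trans (sym even-s) same-s) (even≥3⇒≥4 k (subst (3 ≤_) even-s (3≤chordDeg-s₀ md))) , tt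
      where
      even≥3⇒≥4 : ∀ k → 3 ≤ 2 * k → 4 ≤ 2 * k
      even≥3⇒≥4 (suc zero)    (s≤s (s≤s ()))
      even≥3⇒≥4 (suc (suc k)) _ = *-monoʳ-≤ 2 (s≤s (s≤s (z≤n {k})))

    unequalCase : ¬ chordDeg s₀ ≡ chordDeg s₁ ⊎ ¬ chordDeg q₀ ≡ chordDeg q₁ → GoodColouring
    unequalCase differ = record
      { chords     = colouring
      ; majority   = majority-from colouring (λ u c _ _ → bound-away u c refl)
                       (λ c → bound-scheduled s₀ c (here refl) refl)
                       (λ c → bound-scheduled s₁ c (there (here refl)) refl)
      ; asymmetric = λ same-s same-q →
          [ (λ ne → ne (chordDeg-cong s₀ s₁ same-s)) , (λ ne → ne (chordDeg-cong q₀ q₁ same-q)) ]′ differ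
      }
      where open FromBalanced [] refl (s₀ ∷ s₁ ∷ []) schedule-s

    oddEndsCase : ∀ k → chordDeg s₀ ≡ chordDeg s₁ → chordDeg s₀ ≡ suc (2 * k) → GoodColouring
    oddEndsCase k same odd = record
      { chords     = colouring
      ; majority   = majority-from colouring
                       (λ u c u≢s₀ u≢s₁ → bound-away u c (virtualDeg-parallel-away (true ∷ []) u≢s₀ u≢s₁))
                       (λ c → subst (λ d → 2 * chordColourDeg colouring s₀ c ≤ chordDeg s₀ + d) vd-s₀
                                (bound-even s₀ c (suc k) (here refl) even))
                       (λ c → subst (λ d → 2 * chordColourDeg colouring s₁ c ≤ chordDeg s₁ + d) vd-s₁
                                (bound-even s₁ c (suc k) (there (here refl)) (trans (sym same′) even)))
      ; asymmetric = λ same-s _ → asymmetric-by-parity s₀ s₁ (suc k) (s₁≢s₀ ∘ sym) (here refl) (there (here refl))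
                                    (parallel-no-stray s₀ s₁ (true ∷ [])) refl even same′ (same-s true)
      }
      where
      open FromBalanced (parallel s₀ s₁ (true ∷ [])) refl (s₀ ∷ s₁ ∷ []) schedule-s
      vd-s₀ : virtualDeg s₀ (parallel s₀ s₁ (true ∷ [])) ≡ 1
      vd-s₀ = virtualDeg-parallel-src (true ∷ []) s₁≢s₀
      vd-s₁ : virtualDeg s₁ (parallel s₀ s₁ (true ∷ [])) ≡ 1
      vd-s₁ = virtualDeg-parallel-dst (true ∷ []) s₁≢s₀
      even : chordDeg s₀ + virtualDeg s₀ (parallel s₀ s₁ (true ∷ [])) ≡ 2 * suc k
      even = trans (cong₂ _+_ odd vd-s₀) (odd+1≡even k)
      same′ : chordDeg s₀ + virtualDeg s₀ (parallel s₀ s₁ (true ∷ [])) ≡ chordDeg s₁ + virtualDeg s₁ (parallel s₀ s₁ (true ∷ []))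
      same′ = cong₂ _+_ same (trans vd-s₀ (sym vd-s₁))

    -- With equal even chord degrees at the ends, the ends have no slack for a virtual edge; the
    -- parity trick is played at q₀ and q₁ instead, which lie on two path edges, adding an untwisted
    -- virtual edge as well when that is needed to make their degrees even.
    evenEndsCase : ∀ k k′ twists → chordDeg s₀ ≡ chordDeg s₁ → chordDeg s₀ ≡ 2 * k → chordDeg q₀ ≡ chordDeg q₁ →
      sumMap (ind ∘ twistedVirtual) (parallel q₀ q₁ twists) ≡ 1 → length twists ≤ 2 →
      chordDeg q₀ + length twists ≡ 2 * k′ → GoodColouring
    evenEndsCase k k′ twists same-s even-s same-q one-twisted few even-q = record
      { chords     = colouring
      ; majority   = majority-from colouring inner
                       (λ c → bound-scheduled s₀ c (there (there (here refl)))
                                (virtualDeg-parallel-away twists (q₀≢s₀ ∘ sym) (q₁≢s₀ ∘ sym)))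
                       (λ c → bound-scheduled s₁ c (there (there (there (here refl))))
                                (virtualDeg-parallel-away twists (q₀≢s₁ ∘ sym) (q₁≢s₁ ∘ sym)))
      ; asymmetric = λ _ same-q′ → asymmetric-by-parity q₀ q₁ k′ (q₁≢q₀ ∘ sym) (here refl) (there (here refl))
                                     (parallel-no-stray q₀ q₁ twists) one-twisted even same (same-q′ true)
      }
      where
      open FromBalanced (parallel q₀ q₁ twists) (parallel-allVirtual q₀ q₁ twists)
                        (q₀ ∷ q₁ ∷ s₀ ∷ s₁ ∷ []) (schedule-q-s k same-s even-s)
      vd-q₀ : virtualDeg q₀ (parallel q₀ q₁ twists) ≡ length twists
      vd-q₀ = virtualDeg-parallel-src twists q₁≢q₀
      vd-q₁ : virtualDeg q₁ (parallel q₀ q₁ twists) ≡ length twists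
      vd-q₁ = virtualDeg-parallel-dst twists q₁≢q₀
      even : chordDeg q₀ + virtualDeg q₀ (parallel q₀ q₁ twists) ≡ 2 * k′
      even = trans (cong (chordDeg q₀ +_) vd-q₀) even-q
      same : chordDeg q₀ + virtualDeg q₀ (parallel q₀ q₁ twists) ≡ chordDeg q₁ + virtualDeg q₁ (parallel q₀ q₁ twists)
      same = cong₂ _+_ same-q (trans vd-q₀ (sym vd-q₁))
      inner : ∀ u c → ¬ u ≡ s₀ → ¬ u ≡ s₁ → 2 * chordColourDeg colouring u c ≤ chordDeg u + 2
      inner u c _ _ = near-q (u ≟ q₀) (u ≟ q₁)
        where
        Bound : V → Set
        Bound x = 2 * chordColourDeg colouring x c ≤ chordDeg x + 2
        near-q : Dec (u ≡ q₀) → Dec (u ≡ q₁) → Bound u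
        near-q (yes u≡q₀) _ = subst Bound (sym u≡q₀)
          (≤-trans (bound-even q₀ c k′ (here refl) even) (+-monoʳ-≤ (chordDeg q₀) (≤-trans (≤-reflexive vd-q₀) few)))
        near-q (no _) (yes u≡q₁) = subst Bound (sym u≡q₁)
          (≤-trans (bound-even q₁ c k′ (there (here refl)) (trans (sym same) even))
                   (+-monoʳ-≤ (chordDeg q₁) (≤-trans (≤-reflexive vd-q₁) few)))
        near-q (no u≢q₀) (no u≢q₁) = bound-away u c (virtualDeg-parallel-away twists u≢q₀ u≢q₁)

    goodColouring : GoodColouring
    goodColouring with chordDeg s₀ ℕ.≟ chordDeg s₁ | chordDeg q₀ ℕ.≟ chordDeg q₁
    ... | no s-differ | _           = unequalCase (inj₁ s-differ)
    ... | yes _       | no q-differ = unequalCase (inj₂ q-differ)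
    ... | yes same-s  | yes same-q with even-or-odd (chordDeg s₀) | even-or-odd (chordDeg q₀)
    ...   | inj₂ (k , odd-s)  | _                 = oddEndsCase k same-s odd-s
    ...   | inj₁ (k , even-s) | inj₂ (k′ , odd-q)  =
      evenEndsCase k (suc k′) (true ∷ []) same-s even-s same-q refl (s≤s z≤n)
        (trans (cong (_+ 1) odd-q) (odd+1≡even k′))
    ...   | inj₁ (k , even-s) | inj₁ (k′ , even-q) =
      evenEndsCase k (suc k′) (true ∷ false ∷ []) same-s even-s same-q refl ≤-refl
        (trans (cong (_+ 2) even-q) (even+2≡even k′))

-- The edge colouring

module FromGoodColouring {m : ℕ} (G : Graph (5 + m)) (path : Traceable G) (md : MinDegree≥ G 4)
             (good : ChordColourings.GoodColouring G path) where
  open HamiltonianPath G path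
  open ChordColourings G path
  open GoodColouring good

  toColour : Bool → Fin 3
  toColour true  = suc zero
  toColour false = suc (suc zero)

  toColour-≟ : ∀ x c → ⌊ toColour x ≟ toColour c ⌋ ≡ (x ==ᵇ c)
  toColour-≟ true  true  = refl
  toColour-≟ true  false = refl
  toColour-≟ false true  = refl
  toColour-≟ false false = refl

  colour : V → V → Fin 3
  colour u v = if pathAdj u v then zero else toColour (colourOf chords u v)

  colour-sym : ∀ u v → colour u v ≡ colour v u
  colour-sym u v rewrite pathAdj-sym u v | colourOf-sym chords u v = refl

  edgeColouring : EdgeColoring G 3
  edgeColouring = record { col = colour ; colSym = λ u v _ → colour-sym u v }

  pathColour-class : ∀ u v → (adj G u v ∧ ⌊ colour u v ≟ zero ⌋) ≡ pathAdj u v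
  pathColour-class u v with pathAdj u v in uv
  ... | true rewrite pathAdj⇒adj u v uv = refl
  ... | false with adj G u v | colourOf chords u v
  ...   | true  | true  = refl
  ...   | true  | false = refl
  ...   | false | _     = refl

  chordColour-class : ∀ u v c → (adj G u v ∧ ⌊ colour u v ≟ toColour c ⌋) ≡ (isChord u v ∧ (colourOf chords u v ==ᵇ c))
  chordColour-class u v c with pathAdj u v | adj G u v
  ... | true  | true  = zero≢toColour c
    where
    zero≢toColour : ∀ c → ⌊ zero ≟ toColour c ⌋ ≡ false
    zero≢toColour true  = refl
    zero≢toColour false = refl
  ... | true  | false = refl
  ... | false | true  = toColour-≟ (colourOf chords u v) c
  ... | false | false = refl

  chordClass-bound : ∀ u c → 2 * count (λ v → adj G u v ∧ ⌊ colour u v ≟ toColour c ⌋) ≤ degree G u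
  chordClass-bound u c = subst (λ z → 2 * z ≤ degree G u) (sym (count-cong (λ v → chordColour-class u v c)))
    (≤-trans (majority u c) (≤-reflexive (sym (degree≡pathDeg+chordDeg u))))

  isMajority : IsMajority edgeColouring
  isMajority u zero             = subst (λ z → 2 * z ≤ degree G u) (sym (count-cong (pathColour-class u)))
                                    (≤-trans (*-monoʳ-≤ 2 (pathDeg≤2 u)) (md u))
  isMajority u (suc zero)       = chordClass-bound u true
  isMajority u (suc (suc zero)) = chordClass-bound u false

  colour≡zero⇒pathAdj : ∀ {u v} → colour u v ≡ zero → pathAdj u v ≡ true
  colour≡zero⇒pathAdj {u} {v} = zero-only-on-path (pathAdj u v) (colourOf chords u v)
    where
    zero-only-on-path : ∀ b x → (if b then zero else toColour x) ≡ zero → b ≡ true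
    zero-only-on-path true  x     _ = refl
    zero-only-on-path false true  ()
    zero-only-on-path false false ()

  colour-off-path : ∀ {u v} → pathAdj u v ≡ false → colour u v ≡ toColour (colourOf chords u v)
  colour-off-path {u} {v} off = cong (λ b → if b then zero else toColour (colourOf chords u v)) off

  toColour-injective : ∀ {x y} → toColour x ≡ toColour y → x ≡ y
  toColour-injective {true}  {true}  _ = refl
  toColour-injective {false} {false} _ = refl

  index-vertexAt-mod : ∀ {k} → k < 5 + m → index (vertexAt (k mod (5 + m))) ≡ k
  index-vertexAt-mod {k} k<n = trans (index-vertexAt _) (trans (toℕ-fromℕ< _) (m<n⇒m%n≡m k<n))

  vertexAt-mod-index : ∀ u → vertexAt (index u mod (5 + m)) ≡ u
  vertexAt-mod-index u = index-injective (index-vertexAt-mod (index<n u))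

  module Preserving (φ : Permutation′ (5 + m)) (aut : IsAutomorphism G φ)
    (pres : ∀ u v → adj G u v ≡ true → colour (φ ⟨$⟩ʳ u) (φ ⟨$⟩ʳ v) ≡ colour u v) where

    image : V → V
    image u = φ ⟨$⟩ʳ u

    image-injective : ∀ {u v} → image u ≡ image v → u ≡ v
    image-injective {u} {v} eq = trans (sym (inverseˡ φ)) (trans (cong (φ ⟨$⟩ˡ_) eq) (inverseˡ φ))

    pathAdj-image : ∀ u v → pathAdj u v ≡ true → pathAdj (image u) (image v) ≡ true
    pathAdj-image u v uv = colour≡zero⇒pathAdj (trans (pres u v (pathAdj⇒adj u v uv))
      (cong (λ b → if b then zero else toColour (colourOf chords u v)) uv))

    -- k mod (5 + m) is just k on the range 0 … 4 + m where moved is used.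
    moved : ℕ → ℕ
    moved k = index (image (vertexAt (k mod (5 + m))))

    moved-index : ∀ u → moved (index u) ≡ index (image u)
    moved-index u = cong (index ∘ image) (vertexAt-mod-index u)

    moved-step : ∀ k → suc k ≤ 4 + m → moved (suc k) ≡ suc (moved k) ⊎ moved k ≡ suc (moved (suc k))
    moved-step k k+1≤ with ∨-true (pathAdj-image a b (cong (_∨ follows b a) a→b))
      where
      a = vertexAt (k mod (5 + m))
      b = vertexAt (suc k mod (5 + m))
      a→b : follows a b ≡ true
      a→b = follows-by-index a b (trans (index-vertexAt-mod (s≤s k+1≤))
                                        (cong suc (sym (index-vertexAt-mod (≤-trans (n≤1+n _) (s≤s k+1≤))))))
    ... | inj₁ forward = inj₁ (does⇒ (_ ℕ.≟ _) forward)
    ... | inj₂ back    = inj₂ (does⇒ (_ ℕ.≟ _) back)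

    moved-injective : ∀ a b → a ≤ 4 + m → b ≤ 4 + m → moved a ≡ moved b → a ≡ b
    moved-injective a b a≤ b≤ eq = begin
      a                                      ≡⟨ index-vertexAt-mod (s≤s a≤) ⟨
      index (vertexAt (a mod (5 + m)))       ≡⟨ cong index (image-injective (index-injective eq)) ⟩
      index (vertexAt (b mod (5 + m)))       ≡⟨ index-vertexAt-mod (s≤s b≤) ⟩
      b                                      ∎
      where open ≡-Reasoning

    open UnitSteps (4 + m) moved moved-step moved-injective (λ k _ → ≤-pred (index<n _)) public
      using (identity-or-reflection)

    fixes-all : (∀ k → k ≤ 4 + m → moved k ≡ k) → ∀ u → image u ≡ u
    fixes-all id u = index-injective (trans (sym (moved-index u)) (id (index u) (≤-pred (index<n u))))

    module Reflection (reflect : ∀ k → k ≤ 4 + m → moved k + k ≡ 4 + m) where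

      index-image : ∀ u → index (image u) + index u ≡ 4 + m
      index-image u = trans (cong (_+ index u) (sym (moved-index u))) (reflect (index u) (≤-pred (index<n u)))

      image-s₀ : image s₀ ≡ s₁
      image-s₀ = index-injective (begin
        index (image s₀)              ≡⟨ +-identityʳ _ ⟨
        index (image s₀) + 0          ≡⟨ cong (index (image s₀) +_) index-s₀ ⟨
        index (image s₀) + index s₀   ≡⟨ index-image s₀ ⟩
        4 + m                         ≡⟨ index-s₁ ⟨
        index s₁                      ∎)
        where open ≡-Reasoning

      image-q₀ : image q₀ ≡ q₁
      image-q₀ = index-injective (+-cancelʳ-≡ 1 _ _ (begin
        index (image q₀) + 1          ≡⟨ cong (index (image q₀) +_) index-q₀ ⟨
        index (image q₀) + index q₀   ≡⟨ index-image q₀ ⟩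
        4 + m                         ≡⟨ +-comm 1 (3 + m) ⟩
        3 + m + 1                     ≡⟨ cong (_+ 1) index-q₁ ⟨
        index q₁ + 1                  ∎))
        where open ≡-Reasoning

      follows-image : ∀ u v → follows (image u) (image v) ≡ follows v u
      follows-image u v = does-⇔ forward backward (index (image v) ℕ.≟ suc (index (image u))) (index u ℕ.≟ suc (index v))
        where
        forward : index (image v) ≡ suc (index (image u)) → index u ≡ suc (index v)
        forward eq = +-cancelˡ-≡ (index (image u)) _ _ (begin
          index (image u) + index u         ≡⟨ index-image u ⟩
          4 + m                             ≡⟨ index-image v ⟨
          index (image v) + index v         ≡⟨ cong (_+ index v) eq ⟩
          suc (index (image u)) + index v   ≡⟨ +-suc (index (image u)) (index v) ⟨
          index (image u) + suc (index v)   ∎)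
          where open ≡-Reasoning
        backward : index u ≡ suc (index v) → index (image v) ≡ suc (index (image u))
        backward eq = +-cancelʳ-≡ (index v) _ _ (begin
          index (image v) + index v         ≡⟨ index-image v ⟩
          4 + m                             ≡⟨ index-image u ⟨
          index (image u) + index u         ≡⟨ cong (index (image u) +_) eq ⟩
          index (image u) + suc (index v)   ≡⟨ +-suc (index (image u)) (index v) ⟩
          suc (index (image u)) + index v   ∎)
          where open ≡-Reasoning

      pathAdj-image≡ : ∀ u v → pathAdj (image u) (image v) ≡ pathAdj u v
      pathAdj-image≡ u v = trans (cong₂ _∨_ (follows-image u v) (follows-image v u)) (∨-comm (follows v u) (follows u v))

      isChord-image : ∀ u v → isChord (image u) (image v) ≡ isChord u v
      isChord-image u v = cong₂ (λ a b → a ∧ not b) (aut u v) (pathAdj-image≡ u v)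

      colourOf-image : ∀ u v → isChord u v ≡ true → colourOf chords (image u) (image v) ≡ colourOf chords u v
      colourOf-image u v chord = toColour-injective (begin
        toColour (colourOf chords (image u) (image v)) ≡⟨ colour-off-path (trans (pathAdj-image≡ u v) off) ⟨
        colour (image u) (image v)                     ≡⟨ pres u v (proj₁ (∧-true chord)) ⟩
        colour u v                                     ≡⟨ colour-off-path off ⟩
        toColour (colourOf chords u v)                 ∎)
        where
        open ≡-Reasoning
        off : pathAdj u v ≡ false
        off = not-true (proj₂ (∧-true chord))

      chordColourDeg-image : ∀ u c → chordColourDeg chords (image u) c ≡ chordColourDeg chords u c
      chordColourDeg-image u c =
        trans (sym (count-permute (λ v → isChord (image u) v ∧ (colourOf chords (image u) v ==ᵇ c)) φ))
              (count-cong pointwise)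
        where
        pointwise : ∀ v → (isChord (image u) (image v) ∧ (colourOf chords (image u) (image v) ==ᵇ c))
                        ≡ (isChord u v ∧ (colourOf chords u v ==ᵇ c))
        pointwise v with isChord u v in chord
        ... | true  = cong₂ (λ a x → a ∧ (x ==ᵇ c)) (trans (isChord-image u v) chord) (colourOf-image u v chord)
        ... | false = cong (_∧ (colourOf chords (image u) (image v) ==ᵇ c)) (trans (isChord-image u v) chord)

      impossible : ⊥
      impossible = asymmetric (λ c → subst (λ x → chordColourDeg chords s₀ c ≡ chordColourDeg chords x c) image-s₀
                                             (sym (chordColourDeg-image s₀ c)))
                              (λ c → subst (λ x → chordColourDeg chords q₀ c ≡ chordColourDeg chords x c) image-q₀
                                             (sym (chordColourDeg-image q₀ c)))

  isDistinguishing : IsDistinguishing edgeColouring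
  isDistinguishing φ aut pres u with Preserving.identity-or-reflection φ aut pres (s≤s z≤n)
  ... | inj₁ id      = Preserving.fixes-all φ aut pres id u
  ... | inj₂ reflect = ⊥-elim (Preserving.Reflection.impossible φ aut pres reflect)

  result : M'D≤ G 3
  result = edgeColouring , isMajority , isDistinguishing

atLeastFive : ∀ {n} (G : Graph n) → MinDegree≥ G 4 → Fin n → ∃ λ m → n ≡ 5 + m
atLeastFive {n} G md u = n ∸ 5 , sym (m+[n∸m]≡n (≤-trans (s≤s (md u)) (count-< (adj G u) u (Graph.irrefl G u))))

M'D≤-empty : (G : Graph 0) → M'D≤ G 3
M'D≤-empty G = record { col = λ () ; colSym = λ () } , (λ ()) , (λ _ _ _ ())

proposition13 : ∀ (n : ℕ) (G : Graph n) → Traceable G → MinDegree≥ G 4 → M'D≤ G 3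
proposition13 zero    G path md = M'D≤-empty G
proposition13 (suc n) G path md with atLeastFive G md zero
... | m , refl = FromGoodColouring.result G path md (ChordColourings.goodColouring G path md)
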